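{- Let $g_1,g_2\in\mathbb N$ and $g=g_1+g_2$. Then: (1) $\nu_{2g_1+1,2g_2+1}(\Delta_{B_g})=(2g_1+1)(2g_2+1)$ and $T^{(4g_1g_2+2g_1+2g_2+1)}_{2g_1+1,2g_2+1}\Delta_{B_g}=\Delta_{\{1,\dots,2g_1+1\}}\otimes\Delta_{\{1,\dots,2g_2+1\}}$ (the first factor in the variables $a_1,\dots,a_{2g_1+1}$, the second in $\alpha_1,\dots,\alpha_{2g_2+1}$); (2) $\nu_{2g_1+1,2g_2+1}(\Delta_{U_g})=(g_1+1)g_2$ and $\nu_{2g_1+1,2g_2+1}(\Delta_{U'_g})=g_1(g_2+1)$; (3) if $e\in\mathcal E_{2g+2}$ satisfies $\{e_1,\dots,e_{2g_1+1}\}=\{1,\dots,2g_1+1\}$, and $e_L=(e_1,\dots,e_{2g_1+1})$, $e_R=(e_{2g_1+2}-(2g_1+1),\dots,e_{2g+2}-(2g_1+1))$, then $T^{(2)}_{2g_1+1,2g_2+1}\psi_e=-\psi'_{e_L}\otimes\psi'_{e_R}$ (with $\psi'_{e_L}$ in the variables $a$ and $\psi'_{e_R}$ in the variables $\alpha$).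
   Context: $\mathbb N=\{1,2,\dots\}$. $\Delta_T=\prod_{i,j\in T,i>j}(a_i-a_j)$; $B_g=\{1,\dots,2g+2\}$, $U_g=\{1,3,\dots,2g+1\}$, $U'_g=B_g\setminus U_g$. For a sequence $e=(e_1,\dots,e_r)$, $\psi'_e=\prod_{i=1}^{r-1}(a_{e_i}-a_{e_{i+1}})$ and $\psi_e=(a_{e_r}-a_{e_1})\psi'_e$; $\mathcal E_r$ is the set of permutations $(e_1,\dots,e_r)$ of $(1,\dots,r)$ with $e_i\equiv i\pmod2$ for all $i$. For $f\in\mathbb C[a_1,\dots,a_{r_1+r_2}]$, $T^{(j)}_{r_1,r_2}(f)$ is the coefficient of $t^j$ in $f(a_1,\dots,a_{r_1},\alpha_1+t,\dots,\alpha_{r_2}+t)$, viewed in $\mathbb C[a_1,\dots,a_{r_1}]\otimes\mathbb C[\alpha_1,\dots,\alpha_{r_2}]$, and $\nu_{r_1,r_2}(f)$ is the degree in $t$ of that expression. -}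

module Defs where

open import Data.Nat as ℕ using (ℕ; zero; suc; _∸_; _<_; _<?_; _≤_)
open import Data.Integer as ℤ using (ℤ; 0ℤ; 1ℤ)
open import Data.Fin using (Fin; zero; suc; fromℕ<; _↑ˡ_; _↑ʳ_; splitAt)
open import Data.Vec using (Vec; _∷_; lookup; replicate; zipWith)
open import Data.Vec.Properties using (≡-dec)
open import Data.List using (List; []; _∷_; map; concatMap; foldr; upTo; allFin; mapMaybe; take; drop)
open import Data.List.Relation.Binary.Permutation.Propositional using (_↭_)
open import Data.List.Membership.Propositional using (_∈_)
open import Data.Product using (_×_; _,_)
open import Data.Sum using (inj₁; inj₂)
open import Data.Maybe using (Maybe; just; nothing)
open import Data.Unit using (⊤)
open import Data.Bool using (if_then_else_)
open import Function.Bundles using (_⇔_)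
open import Relation.Nullary using (¬_; yes; no)
open import Relation.Binary.PropositionalEquality using (_≡_)

-- Two polynomials are equal iff all their
-- coefficients agree (see _≈P_); the list representation itself is
-- not normalised.

Monomial : ℕ → Set
Monomial n = Vec ℕ n

Poly : ℕ → Set
Poly n = List (ℤ × Monomial n)

coeff : ∀ {n} → Poly n → Monomial n → ℤ
coeff [] m = 0ℤ
coeff ((c , k) ∷ p) m with ≡-dec ℕ._≟_ k m
... | yes _ = c ℤ.+ coeff p m
... | no  _ = coeff p m

_≈P_ : ∀ {n} → Poly n → Poly n → Set
p ≈P q = ∀ m → coeff p m ≡ coeff q m

IsZeroP : ∀ {n} → Poly n → Set
IsZeroP p = ∀ m → coeff p m ≡ 0ℤ

zeroP : ∀ {n} → Poly n
zeroP = []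

oneP : ∀ {n} → Poly n
oneP {n} = (1ℤ , replicate n 0) ∷ []

varP : ∀ {n} → Fin n → Poly n
varP {suc n} zero    = (1ℤ , 1 ∷ replicate n 0) ∷ []
varP {suc n} (suc i) = map (λ { (c , k) → (c , 0 ∷ k) }) (varP i)

infixl 6 _+P_ _-P_
infixl 7 _*P_

_+P_ : ∀ {n} → Poly n → Poly n → Poly n
[] +P q = q
(t ∷ p) +P q = t ∷ (p +P q)

scaleP : ∀ {n} → ℤ → Poly n → Poly n
scaleP c = map (λ { (d , k) → (c ℤ.* d , k) })

negP : ∀ {n} → Poly n → Poly n
negP = scaleP (ℤ.- 1ℤ)

_-P_ : ∀ {n} → Poly n → Poly n → Poly n
p -P q = p +P negP q

_*P_ : ∀ {n} → Poly n → Poly n → Poly n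
p *P q = concatMap (λ { (c , m) → map (λ { (d , k) → (c ℤ.* d , zipWith ℕ._+_ m k) }) q }) p

powP : ∀ {n} → Poly n → ℕ → Poly n
powP p zero    = oneP
powP p (suc k) = p *P powP p k

prodP : ∀ {n} → List (Poly n) → Poly n
prodP = foldr _*P_ oneP

substP : ∀ {n m} → (Fin n → Poly m) → Poly n → Poly m
substP {n} σ p = foldr _+P_ zeroP
  (map (λ { (c , k) → scaleP c (foldr (λ i acc → powP (σ i) (lookup k i) *P acc) oneP (allFin n)) }) p)

-- the variable a_k (1-based index k) of Poly n; (zero if k ∉ {1..n},
-- which never happens below)
X : (n : ℕ) → ℕ → Poly n
X n k with (k ∸ 1) <? n
... | yes p = varP (fromℕ< p)
... | no  _ = zeroP

-- Target ring ℤ[t, a₁,…,a_{r₁}, α₁,…,α_{r₂}] = Poly (suc (r₁ + r₂)),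
-- variable 0 is t, variable 1+i (i < r₁) is a_{i+1}, variable
-- 1+r₁+j is α_{j+1}.

shiftσ : (r₁ r₂ : ℕ) → Fin (r₁ ℕ.+ r₂) → Poly (suc (r₁ ℕ.+ r₂))
shiftσ r₁ r₂ i with splitAt r₁ i
... | inj₁ k = varP (suc (k ↑ˡ r₂))
... | inj₂ k = varP (suc (r₁ ↑ʳ k)) +P varP zero

tCoeff : ∀ {m} → ℕ → Poly (suc m) → Poly m
tCoeff j = mapMaybe (λ { (c , (e ∷ es)) → if e ℕ.≡ᵇ j then just (c , es) else nothing })

-- T^{(j)}_{r₁,r₂}(f), an element of ℤ[a₁..a_{r₁}] ⊗ ℤ[α₁..α_{r₂}]
-- ≅ ℤ[a₁..a_{r₁},α₁..α_{r₂}] = Poly (r₁ + r₂)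
T : (j r₁ r₂ : ℕ) → Poly (r₁ ℕ.+ r₂) → Poly (r₁ ℕ.+ r₂)
T j r₁ r₂ f = tCoeff j (substP (shiftσ r₁ r₂) f)

HasNu : (r₁ r₂ : ℕ) → Poly (r₁ ℕ.+ r₂) → ℕ → Set
HasNu r₁ r₂ f d = (¬ IsZeroP (T d r₁ r₂ f)) × (∀ j → d < j → IsZeroP (T j r₁ r₂ f))

_⊗P_ : ∀ {r₁ r₂} → Poly r₁ → Poly r₂ → Poly (r₁ ℕ.+ r₂)
_⊗P_ {r₁} {r₂} f h = substP (λ i → varP (i ↑ˡ r₂)) f *P substP (λ i → varP (r₁ ↑ʳ i)) h

range1 : ℕ → List ℕ
range1 r = map suc (upTo r)

B : ℕ → List ℕ
B g = range1 (2 ℕ.* g ℕ.+ 2)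

U : ℕ → List ℕ
U g = map (λ k → 2 ℕ.* k ℕ.+ 1) (upTo (suc g))

-- U'_g = B_g ∖ U_g = {2,4,…,2g+2}
U' : ℕ → List ℕ
U' g = map (λ k → 2 ℕ.* k ℕ.+ 2) (upTo (suc g))

Δ : (n : ℕ) → List ℕ → Poly n
Δ n S = prodP (concatMap (λ i → concatMap (λ j → if j ℕ.<ᵇ i then (X n i -P X n j) ∷ [] else []) S) S)

ψ' : (n : ℕ) → List ℕ → Poly n
ψ' n (x ∷ y ∷ e) = (X n x -P X n y) *P ψ' n (y ∷ e)
ψ' n _ = oneP

lastOr : ℕ → List ℕ → ℕ
lastOr d [] = d
lastOr d (x ∷ e) = lastOr x e

ψ : (n : ℕ) → List ℕ → Poly n
ψ n [] = oneP
ψ n (x ∷ e) = (X n (lastOr x e) -P X n x) *P ψ' n (x ∷ e)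

ParityFrom : ℕ → List ℕ → Set
ParityFrom i [] = ⊤
ParityFrom i (x ∷ e) = (x ℕ.% 2 ≡ i ℕ.% 2) × ParityFrom (suc i) e

InE : ℕ → List ℕ → Set
InE r e = (e ↭ range1 r) × ParityFrom 1 e

SameSet : List ℕ → List ℕ → Set
SameSet xs ys = ∀ x → (x ∈ xs) ⇔ (x ∈ ys)

{-# OPTIONS --safe #-}
-- Under the shift a_i ↦ α_i + t (i > r₁) a difference a_i − a_j with i > j is
-- unchanged when i and j lie on the same side of r₁, and becomes (α_i − a_j) + t
-- when only i lies on the right. So for Δ_S the t-degree is the number of such
-- mixed pairs and the top coefficient is the product of the remaining factors;
-- it is non-zero because its value at a_k = k is a product of non-zero integers,
-- and for S = B_g it splits as Δ ⊗ Δ. In ψ_e, when e_1, …, e_{r₁} fill the left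
-- block, exactly two differences are mixed, with opposite orientations, so the
-- t² coefficient is −ψ'_{e_L} ⊗ ψ'_{e_R}.
module Submission where

open import Defs
open import Algebra.Bundles using (CommutativeRing)
import Algebra.Properties.CommutativeSemigroup as CommutativeSemigroupProperties
open import Data.Bool using (Bool; true; false; if_then_else_; _∧_; not) renaming (T to IsTrue)
open import Data.Empty using (⊥)
open import Data.Fin as Fin using (Fin; zero; suc; toℕ; fromℕ<; _↑ˡ_; _↑ʳ_)
open import Data.Fin.Properties
  using (toℕ-fromℕ<; toℕ-injective; toℕ<n; toℕ-↑ˡ; toℕ-↑ʳ; splitAt-↑ˡ; splitAt-↑ʳ)
open import Data.Integer as ℤ using (ℤ; 0ℤ; 1ℤ)
import Data.Integer.Properties as ℤP
open import Data.List
  using (List; []; _∷_; _++_; map; concatMap; foldr; allFin; length; applyUpTo; upTo; take; drop)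
open import Data.List.Membership.Propositional using (_∈_)
open import Data.List.Membership.Propositional.Properties
  using (∈-++⁻; ∈-++⁺ʳ; ∈-map⁺; ∈-map⁻; ∈-upTo⁺; ∈-upTo⁻; ∈-applyUpTo⁻)
open import Data.List.Properties
  using (map-tabulate; foldr-map; map-id; map-++; map-∘; map-cong; map-upTo;
         length-map; length-upTo; length-applyUpTo; length-take; length-drop; take++drop≡id)
open import Data.List.Relation.Binary.Permutation.Propositional using (_↭_; ↭-sym; ↭⇒↭ₛ)
open import Data.List.Relation.Binary.Permutation.Propositional.Properties using (∈-resp-↭; ↭-length)
import Data.List.Relation.Unary.All as All
open import Data.List.Relation.Unary.Any using (here; there)
open import Data.List.Relation.Unary.Unique.Propositional using (Unique; _∷_)
import Data.List.Relation.Unary.Unique.Propositional.Properties as Unique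
open import Data.Nat as ℕ using (ℕ; zero; suc; _+_; _*_; _∸_; _≤_; _<_; z≤n; s≤s)
import Data.Nat.Properties as ℕP
open import Data.Nat.Tactic.RingSolver using (solve-∀)
open import Data.Product using (_×_; _,_; proj₁; proj₂; ∃-syntax)
open import Data.Sum using (inj₁; inj₂)
open import Data.Unit using (tt)
open import Data.Vec using ([]; _∷_; replicate; zipWith; lookup)
open import Data.Vec.Properties using (≡-dec)
open import Function using (_∘_)
open import Function.Bundles using (Equivalence)
open import Level using (0ℓ)
open import Relation.Binary.PropositionalEquality
open import Relation.Nullary using (yes; no; contradiction)

open import Data.List.Relation.Binary.Permutation.Setoid.Properties (setoid ℕ) using (Unique-resp-↭)
module ℤ+ = CommutativeSemigroupProperties ℤP.+-commutativeSemigroup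
module ℤ* = CommutativeSemigroupProperties ℤP.*-commutativeSemigroup

private variable n m : ℕ

-- Polynomials are unnormalised lists of terms, so they are compared through
-- their pairing with arbitrary weights on monomials: ring laws then become
-- identities in ℤ, and point-mass weights recover the coefficients.

Weight : ℕ → Set
Weight n = Monomial n → ℤ

⟪_∣_⟫ : Poly n → Weight n → ℤ
⟪ [] ∣ w ⟫ = 0ℤ
⟪ (c , k) ∷ p ∣ w ⟫ = c ℤ.* w k ℤ.+ ⟪ p ∣ w ⟫

pair-cong : ∀ (p : Poly n) {w w′ : Weight n} → (∀ k → w k ≡ w′ k) →
            ⟪ p ∣ w ⟫ ≡ ⟪ p ∣ w′ ⟫
pair-cong [] eq = refl
pair-cong ((c , k) ∷ p) eq = cong₂ (λ a b → c ℤ.* a ℤ.+ b) (eq k) (pair-cong p eq)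

pair-++ : ∀ (p q : Poly n) w → ⟪ p ++ q ∣ w ⟫ ≡ ⟪ p ∣ w ⟫ ℤ.+ ⟪ q ∣ w ⟫
pair-++ [] q w = sym (ℤP.+-identityˡ _)
pair-++ ((c , k) ∷ p) q w =
  trans (cong (ℤ._+_ (c ℤ.* w k)) (pair-++ p q w)) (sym (ℤP.+-assoc (c ℤ.* w k) _ _))

pair-+P : ∀ (p q : Poly n) w → ⟪ p +P q ∣ w ⟫ ≡ ⟪ p ∣ w ⟫ ℤ.+ ⟪ q ∣ w ⟫
pair-+P [] q w = sym (ℤP.+-identityˡ _)
pair-+P ((c , k) ∷ p) q w =
  trans (cong (ℤ._+_ (c ℤ.* w k)) (pair-+P p q w)) (sym (ℤP.+-assoc (c ℤ.* w k) _ _))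

pair-map : ∀ (h : ℤ × Monomial n → ℤ × Monomial m) (s : ℤ) (φ : Monomial n → Monomial m) →
           (∀ c k → h (c , k) ≡ (s ℤ.* c , φ k)) →
           ∀ p w → ⟪ map h p ∣ w ⟫ ≡ s ℤ.* ⟪ p ∣ w ∘ φ ⟫
pair-map h s φ eq [] w = sym (ℤP.*-zeroʳ s)
pair-map h s φ eq ((c , k) ∷ p) w rewrite eq c k = begin
  s ℤ.* c ℤ.* w (φ k) ℤ.+ ⟪ map h p ∣ w ⟫
    ≡⟨ cong₂ ℤ._+_ (ℤP.*-assoc s c _) (pair-map h s φ eq p w) ⟩
  s ℤ.* (c ℤ.* w (φ k)) ℤ.+ s ℤ.* ⟪ p ∣ w ∘ φ ⟫
    ≡⟨ sym (ℤP.*-distribˡ-+ s _ _) ⟩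
  s ℤ.* ⟪ (c , k) ∷ p ∣ w ∘ φ ⟫ ∎
  where open ≡-Reasoning

pair-renameMonomials : ∀ (h : ℤ × Monomial n → ℤ × Monomial m) (φ : Monomial n → Monomial m) →
                       (∀ c k → h (c , k) ≡ (c , φ k)) →
                       ∀ p w → ⟪ map h p ∣ w ⟫ ≡ ⟪ p ∣ w ∘ φ ⟫
pair-renameMonomials h φ eq p w =
  trans (pair-map h 1ℤ φ (λ c k → trans (eq c k) (cong (_, φ k) (sym (ℤP.*-identityˡ c)))) p w)
        (ℤP.*-identityˡ _)

pair-+ʷ : ∀ (p : Poly n) w w′ →
          ⟪ p ∣ (λ k → w k ℤ.+ w′ k) ⟫ ≡ ⟪ p ∣ w ⟫ ℤ.+ ⟪ p ∣ w′ ⟫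
pair-+ʷ [] w w′ = refl
pair-+ʷ ((c , k) ∷ p) w w′ =
  trans (cong₂ ℤ._+_ (ℤP.*-distribˡ-+ c (w k) (w′ k)) (pair-+ʷ p w w′))
        (ℤ+.interchange (c ℤ.* w k) (c ℤ.* w′ k) _ _)

pair-*ʷ : ∀ (p : Poly n) s w → ⟪ p ∣ (λ k → s ℤ.* w k) ⟫ ≡ s ℤ.* ⟪ p ∣ w ⟫
pair-*ʷ [] s w = sym (ℤP.*-zeroʳ s)
pair-*ʷ ((c , k) ∷ p) s w =
  trans (cong₂ ℤ._+_ (ℤ*.x∙yz≈y∙xz c s (w k)) (pair-*ʷ p s w)) (sym (ℤP.*-distribˡ-+ s _ _))

pair-0ʷ : ∀ (p : Poly n) → ⟪ p ∣ (λ _ → 0ℤ) ⟫ ≡ 0ℤ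
pair-0ʷ p = trans (pair-*ʷ p 0ℤ (λ _ → 0ℤ)) refl

pair-swap : ∀ (p : Poly n) (q : Poly m) (W : Monomial n → Monomial m → ℤ) →
            ⟪ p ∣ (λ a → ⟪ q ∣ W a ⟫) ⟫ ≡ ⟪ q ∣ (λ b → ⟪ p ∣ (λ a → W a b) ⟫) ⟫
pair-swap [] q W = sym (pair-0ʷ q)
pair-swap ((c , k) ∷ p) q W = begin
  c ℤ.* ⟪ q ∣ W k ⟫ ℤ.+ ⟪ p ∣ (λ a → ⟪ q ∣ W a ⟫) ⟫
    ≡⟨ cong₂ ℤ._+_ (sym (pair-*ʷ q c (W k))) (pair-swap p q W) ⟩
  ⟪ q ∣ (λ b → c ℤ.* W k b) ⟫ ℤ.+ ⟪ q ∣ (λ b → ⟪ p ∣ (λ a → W a b) ⟫) ⟫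
    ≡⟨ sym (pair-+ʷ q _ _) ⟩
  ⟪ q ∣ (λ b → c ℤ.* W k b ℤ.+ ⟪ p ∣ (λ a → W a b) ⟫) ⟫ ∎
  where open ≡-Reasoning

pair-concatMap : ∀ (G : ℤ × Monomial n → Poly n) {w} (V : Weight n) →
                 (∀ c k → ⟪ G (c , k) ∣ w ⟫ ≡ c ℤ.* V k) →
                 ∀ p → ⟪ concatMap G p ∣ w ⟫ ≡ ⟪ p ∣ V ⟫
pair-concatMap G V eq [] = refl
pair-concatMap G {w} V eq ((c , k) ∷ p) =
  trans (pair-++ (G (c , k)) (concatMap G p) w) (cong₂ ℤ._+_ (eq c k) (pair-concatMap G V eq p))

infixl 6 _⊕_
_⊕_ : Monomial n → Monomial n → Monomial n
_⊕_ = zipWith ℕ._+_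

pair-*P : ∀ (p q : Poly n) w →
          ⟪ p *P q ∣ w ⟫ ≡ ⟪ p ∣ (λ a → ⟪ q ∣ (λ b → w (a ⊕ b)) ⟫) ⟫
pair-*P p q w = pair-concatMap _ _ (λ c k → pair-map _ c (k ⊕_) (λ _ _ → refl) q w) p

pair-scaleP : ∀ (s : ℤ) (p : Poly n) w → ⟪ scaleP s p ∣ w ⟫ ≡ s ℤ.* ⟪ p ∣ w ⟫
pair-scaleP s = pair-map _ s (λ k → k) (λ _ _ → refl)

pair-negP : ∀ (p : Poly n) w → ⟪ negP p ∣ w ⟫ ≡ ℤ.- ⟪ p ∣ w ⟫
pair-negP p w = trans (pair-scaleP (ℤ.- 1ℤ) p w) (ℤP.-1*i≡-i _)

pair-oneP : ∀ w → ⟪ oneP {n} ∣ w ⟫ ≡ w (replicate n 0)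
pair-oneP w = trans (ℤP.+-identityʳ _) (ℤP.*-identityˡ _)

infix 4 _≃_
record _≃_ (p q : Poly n) : Set where
  constructor mk≃
  field pair-≡ : ∀ w → ⟪ p ∣ w ⟫ ≡ ⟪ q ∣ w ⟫
open _≃_ public

pointMass : Monomial n → Weight n
pointMass m k with ≡-dec ℕ._≟_ k m
... | yes _ = 1ℤ
... | no _ = 0ℤ

coeff≡pair-pointMass : ∀ (p : Poly n) m → coeff p m ≡ ⟪ p ∣ pointMass m ⟫
coeff≡pair-pointMass [] m = refl
coeff≡pair-pointMass ((c , k) ∷ p) m with ≡-dec ℕ._≟_ k m
... | yes _ = cong₂ ℤ._+_ (sym (ℤP.*-identityʳ c)) (coeff≡pair-pointMass p m)
... | no _ = trans (coeff≡pair-pointMass p m) (trans (sym (ℤP.+-identityˡ _))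
                   (cong (λ z → z ℤ.+ ⟪ p ∣ pointMass m ⟫) (sym (ℤP.*-zeroʳ c))))

≃⇒≈P : {p q : Poly n} → p ≃ q → p ≈P q
≃⇒≈P {p = p} {q} p≃q m =
  trans (coeff≡pair-pointMass p m) (trans (pair-≡ p≃q (pointMass m)) (sym (coeff≡pair-pointMass q m)))

⊕-comm : ∀ (a b : Monomial n) → a ⊕ b ≡ b ⊕ a
⊕-comm [] [] = refl
⊕-comm (x ∷ a) (y ∷ b) = cong₂ _∷_ (ℕP.+-comm x y) (⊕-comm a b)

⊕-assoc : ∀ (a b c : Monomial n) → (a ⊕ b) ⊕ c ≡ a ⊕ (b ⊕ c)
⊕-assoc [] [] [] = refl
⊕-assoc (x ∷ a) (y ∷ b) (z ∷ c) = cong₂ _∷_ (ℕP.+-assoc x y z) (⊕-assoc a b c)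

⊕-identityˡ : ∀ (a : Monomial n) → replicate n 0 ⊕ a ≡ a
⊕-identityˡ [] = refl
⊕-identityˡ (x ∷ a) = cong (x ∷_) (⊕-identityˡ a)

≃-refl : {p : Poly n} → p ≃ p
≃-refl = mk≃ λ _ → refl

≃-sym : {p q : Poly n} → p ≃ q → q ≃ p
≃-sym p≃q = mk≃ λ w → sym (pair-≡ p≃q w)

≃-trans : {p q r : Poly n} → p ≃ q → q ≃ r → p ≃ r
≃-trans p≃q q≃r = mk≃ λ w → trans (pair-≡ p≃q w) (pair-≡ q≃r w)

≡⇒≃ : {p q : Poly n} → p ≡ q → p ≃ q
≡⇒≃ refl = ≃-refl

+P-cong : {p p′ q q′ : Poly n} → p ≃ p′ → q ≃ q′ → p +P q ≃ p′ +P q′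
+P-cong {p = p} {p′} {q} {q′} p≃p′ q≃q′ = mk≃ λ w →
  trans (pair-+P p q w)
        (trans (cong₂ ℤ._+_ (pair-≡ p≃p′ w) (pair-≡ q≃q′ w)) (sym (pair-+P p′ q′ w)))

negP-cong : {p q : Poly n} → p ≃ q → negP p ≃ negP q
negP-cong {p = p} {q} p≃q = mk≃ λ w →
  trans (pair-negP p w) (trans (cong ℤ.-_ (pair-≡ p≃q w)) (sym (pair-negP q w)))

*P-cong : {p p′ q q′ : Poly n} → p ≃ p′ → q ≃ q′ → p *P q ≃ p′ *P q′
*P-cong {p = p} {p′} {q} {q′} p≃p′ q≃q′ = mk≃ λ w → begin
  ⟪ p *P q ∣ w ⟫                               ≡⟨ pair-*P p q w ⟩
  ⟪ p ∣ (λ a → ⟪ q ∣ (λ b → w (a ⊕ b)) ⟫) ⟫   ≡⟨ pair-cong p (λ _ → pair-≡ q≃q′ _) ⟩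
  ⟪ p ∣ (λ a → ⟪ q′ ∣ (λ b → w (a ⊕ b)) ⟫) ⟫  ≡⟨ pair-≡ p≃p′ _ ⟩
  ⟪ p′ ∣ (λ a → ⟪ q′ ∣ (λ b → w (a ⊕ b)) ⟫) ⟫ ≡⟨ sym (pair-*P p′ q′ w) ⟩
  ⟪ p′ *P q′ ∣ w ⟫                             ∎
  where open ≡-Reasoning

+P-assoc : (p q r : Poly n) → (p +P q) +P r ≃ p +P (q +P r)
+P-assoc p q r = mk≃ λ w → begin
  ⟪ (p +P q) +P r ∣ w ⟫                    ≡⟨ pair-+P (p +P q) r w ⟩
  ⟪ p +P q ∣ w ⟫ ℤ.+ ⟪ r ∣ w ⟫             ≡⟨ cong (ℤ._+ ⟪ r ∣ w ⟫) (pair-+P p q w) ⟩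
  ⟪ p ∣ w ⟫ ℤ.+ ⟪ q ∣ w ⟫ ℤ.+ ⟪ r ∣ w ⟫    ≡⟨ ℤP.+-assoc ⟪ p ∣ w ⟫ _ _ ⟩
  ⟪ p ∣ w ⟫ ℤ.+ (⟪ q ∣ w ⟫ ℤ.+ ⟪ r ∣ w ⟫)  ≡⟨ cong (ℤ._+_ ⟪ p ∣ w ⟫) (sym (pair-+P q r w)) ⟩
  ⟪ p ∣ w ⟫ ℤ.+ ⟪ q +P r ∣ w ⟫             ≡⟨ sym (pair-+P p (q +P r) w) ⟩
  ⟪ p +P (q +P r) ∣ w ⟫                    ∎
  where open ≡-Reasoning

+P-comm : (p q : Poly n) → p +P q ≃ q +P p
+P-comm p q = mk≃ λ w →
  trans (pair-+P p q w) (trans (ℤP.+-comm ⟪ p ∣ w ⟫ _) (sym (pair-+P q p w)))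

+P-identityˡ : (p : Poly n) → zeroP +P p ≃ p
+P-identityˡ p = ≃-refl

+P-identityʳ : (p : Poly n) → p +P zeroP ≃ p
+P-identityʳ p = mk≃ λ w → trans (pair-+P p zeroP w) (ℤP.+-identityʳ _)

negP-inverseˡ : (p : Poly n) → negP p +P p ≃ zeroP
negP-inverseˡ p = mk≃ λ w →
  trans (pair-+P (negP p) p w)
        (trans (cong (λ z → z ℤ.+ ⟪ p ∣ w ⟫) (pair-negP p w)) (ℤP.+-inverseˡ ⟪ p ∣ w ⟫))

negP-inverseʳ : (p : Poly n) → p +P negP p ≃ zeroP
negP-inverseʳ p = ≃-trans (+P-comm p (negP p)) (negP-inverseˡ p)

*P-assoc : (p q r : Poly n) → (p *P q) *P r ≃ p *P (q *P r)
*P-assoc p q r = mk≃ λ w → begin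
  ⟪ (p *P q) *P r ∣ w ⟫
    ≡⟨ trans (pair-*P (p *P q) r w) (pair-*P p q _) ⟩
  ⟪ p ∣ (λ a → ⟪ q ∣ (λ b → ⟪ r ∣ (λ c → w ((a ⊕ b) ⊕ c)) ⟫) ⟫) ⟫
    ≡⟨ pair-cong p (λ a → pair-cong q (λ b → pair-cong r (λ c → cong w (⊕-assoc a b c)))) ⟩
  ⟪ p ∣ (λ a → ⟪ q ∣ (λ b → ⟪ r ∣ (λ c → w (a ⊕ (b ⊕ c))) ⟫) ⟫) ⟫
    ≡⟨ sym (trans (pair-*P p (q *P r) w) (pair-cong p (λ a → pair-*P q r _))) ⟩
  ⟪ p *P (q *P r) ∣ w ⟫ ∎
  where open ≡-Reasoning

*P-comm : (p q : Poly n) → p *P q ≃ q *P p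
*P-comm p q = mk≃ λ w → begin
  ⟪ p *P q ∣ w ⟫
    ≡⟨ pair-*P p q w ⟩
  ⟪ p ∣ (λ a → ⟪ q ∣ (λ b → w (a ⊕ b)) ⟫) ⟫
    ≡⟨ pair-swap p q _ ⟩
  ⟪ q ∣ (λ b → ⟪ p ∣ (λ a → w (a ⊕ b)) ⟫) ⟫
    ≡⟨ pair-cong q (λ b → pair-cong p (λ a → cong w (⊕-comm a b))) ⟩
  ⟪ q ∣ (λ b → ⟪ p ∣ (λ a → w (b ⊕ a)) ⟫) ⟫
    ≡⟨ sym (pair-*P q p w) ⟩
  ⟪ q *P p ∣ w ⟫ ∎
  where open ≡-Reasoning

*P-identityˡ : (p : Poly n) → oneP *P p ≃ p
*P-identityˡ p = mk≃ λ w →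
  trans (pair-*P oneP p w)
        (trans (pair-oneP (λ a → ⟪ p ∣ (λ b → w (a ⊕ b)) ⟫))
               (pair-cong p (λ b → cong w (⊕-identityˡ b))))

*P-identityʳ : (p : Poly n) → p *P oneP ≃ p
*P-identityʳ p = ≃-trans (*P-comm p oneP) (*P-identityˡ p)

*P-zeroʳ : (p : Poly n) → p *P zeroP ≃ zeroP
*P-zeroʳ p = mk≃ λ w → trans (pair-*P p zeroP w) (pair-0ʷ p)

*P-distribʳ-+P : (p q r : Poly n) → (q +P r) *P p ≃ q *P p +P r *P p
*P-distribʳ-+P p q r = mk≃ λ w →
  trans (pair-*P (q +P r) p w)
  (trans (pair-+P q r _)
  (sym (trans (pair-+P (q *P p) (r *P p) w) (cong₂ ℤ._+_ (pair-*P q p w) (pair-*P r p w)))))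

*P-distribˡ-+P : (p q r : Poly n) → p *P (q +P r) ≃ p *P q +P p *P r
*P-distribˡ-+P p q r =
  ≃-trans (*P-comm p (q +P r))
  (≃-trans (*P-distribʳ-+P p q r) (+P-cong (*P-comm q p) (*P-comm r p)))

Poly-commutativeRing : ℕ → CommutativeRing 0ℓ 0ℓ
Poly-commutativeRing n = record
  { Carrier = Poly n
  ; _≈_ = _≃_
  ; _+_ = _+P_
  ; _*_ = _*P_
  ; -_ = negP
  ; 0# = zeroP
  ; 1# = oneP
  ; isCommutativeRing = record
    { isRing = record
      { +-isAbelianGroup = record
        { isGroup = record
          { isMonoid = record
            { isSemigroup = record
              { isMagma = record
                { isEquivalence = record { refl = ≃-refl ; sym = ≃-sym ; trans = ≃-trans }
                ; ∙-cong = +P-cong }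
              ; assoc = +P-assoc }
            ; identity = +P-identityˡ , +P-identityʳ }
          ; inverse = negP-inverseˡ , negP-inverseʳ
          ; ⁻¹-cong = negP-cong }
        ; comm = +P-comm }
      ; *-cong = *P-cong
      ; *-assoc = *P-assoc
      ; *-identity = *P-identityˡ , *P-identityʳ
      ; distrib = *P-distribˡ-+P , *P-distribʳ-+P }
    ; *-comm = *P-comm }
  }

module PolySolver (n : ℕ) where
  open import Algebra.Solver.Ring.AlmostCommutativeRing
    using (AlmostCommutativeRing; fromCommutativeRing; _-Raw-AlmostCommutative⟶_)
  open import Data.Maybe using (Maybe; just; nothing)

  constP : ℤ → Poly n
  constP c = (c , replicate n 0) ∷ []

  pair-constP : ∀ c w → ⟪ constP c ∣ w ⟫ ≡ c ℤ.* w (replicate n 0)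
  pair-constP c w = ℤP.+-identityʳ _

  constP-homomorphism :
    CommutativeRing.rawRing ℤP.+-*-commutativeRing -Raw-AlmostCommutative⟶
    fromCommutativeRing (Poly-commutativeRing n)
  constP-homomorphism = record
    { ⟦_⟧ = constP
    ; +-homo = λ c d → mk≃ λ w → trans (pair-constP (c ℤ.+ d) w)
        (trans (ℤP.*-distribʳ-+ (w _) c d) (sym (trans (pair-+P (constP c) (constP d) w)
          (cong₂ ℤ._+_ (pair-constP c w) (pair-constP d w)))))
    ; *-homo = λ c d → mk≃ λ w → trans (pair-constP (c ℤ.* d) w)
        (trans (ℤP.*-assoc c d _) (sym (trans (pair-*P (constP c) (constP d) w)
          (trans (pair-constP c (λ a → ⟪ constP d ∣ (λ b → w (a ⊕ b)) ⟫))
            (cong (c ℤ.*_) (trans (pair-constP d (λ b → w (replicate n 0 ⊕ b)))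
              (cong (λ k → d ℤ.* w k) (⊕-identityˡ (replicate n 0)))))))))
    ; -‿homo = λ c → mk≃ λ w → trans (pair-constP (ℤ.- c) w)
        (trans (sym (ℤP.neg-distribˡ-* c _)) (sym (trans (pair-negP (constP c) w)
          (cong ℤ.-_ (pair-constP c w)))))
    ; 0-homo = mk≃ λ w → pair-constP 0ℤ w
    ; 1-homo = ≃-refl
    }

  constP-≟ : (c d : ℤ) → Maybe (constP c ≃ constP d)
  constP-≟ c d with c ℤ.≟ d
  ... | yes refl = just ≃-refl
  ... | no _ = nothing

  open import Algebra.Solver.Ring (CommutativeRing.rawRing ℤP.+-*-commutativeRing)
    (fromCommutativeRing (Poly-commutativeRing n)) constP-homomorphism constP-≟ public
  open import Relation.Binary.Reasoning.Setoid (CommutativeRing.setoid (Poly-commutativeRing n)) public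

embed : Poly n → Poly (suc n)
embed = map (λ { (c , k) → (c , 0 ∷ k) })

tVar : Poly (suc n)
tVar = varP zero

pair-embed : ∀ (p : Poly n) w → ⟪ embed p ∣ w ⟫ ≡ ⟪ p ∣ (λ k → w (0 ∷ k)) ⟫
pair-embed = pair-renameMonomials _ (0 ∷_) (λ _ _ → refl)

pair-tVar : ∀ w → ⟪ tVar {n} ∣ w ⟫ ≡ w (1 ∷ replicate n 0)
pair-tVar w = pair-oneP (λ k → w (1 ∷ k))

embed-+P : (p q : Poly n) → embed (p +P q) ≃ embed p +P embed q
embed-+P p q = mk≃ λ w → trans (pair-embed (p +P q) w) (trans (pair-+P p q _)
  (sym (trans (pair-+P (embed p) (embed q) w) (cong₂ ℤ._+_ (pair-embed p w) (pair-embed q w)))))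

embed-negP : (p : Poly n) → embed (negP p) ≃ negP (embed p)
embed-negP p = mk≃ λ w → trans (pair-embed (negP p) w) (trans (pair-negP p _)
  (sym (trans (pair-negP (embed p) w) (cong ℤ.-_ (pair-embed p w)))))

embed--P : (p q : Poly n) → embed (p -P q) ≃ embed p -P embed q
embed--P p q = ≃-trans (embed-+P p (negP q)) (+P-cong ≃-refl (embed-negP q))

embed-*P : (p q : Poly n) → embed (p *P q) ≃ embed p *P embed q
embed-*P p q = mk≃ λ w → trans (pair-embed (p *P q) w) (trans (pair-*P p q _)
  (sym (trans (pair-*P (embed p) (embed q) w) (trans (pair-embed p _) (pair-cong p (λ a → pair-embed q _))))))

embed-varP : (i : Fin n) → embed (varP i) ≃ varP (suc i)
embed-varP i = mk≃ λ w →
  trans (pair-embed (varP i) w) (sym (pair-renameMonomials _ (0 ∷_) (λ _ _ → refl) (varP i) w))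

atTDegree : ℕ → Weight n → Weight (suc n)
atTDegree j w (e ∷ es) = if e ℕ.≡ᵇ j then w es else 0ℤ

pair-tCoeff : ∀ j (p : Poly (suc n)) w → ⟪ tCoeff j p ∣ w ⟫ ≡ ⟪ p ∣ atTDegree j w ⟫
pair-tCoeff j [] w = refl
pair-tCoeff j ((c , e ∷ es) ∷ p) w with e ℕ.≡ᵇ j
... | true = cong (ℤ._+_ (c ℤ.* w es)) (pair-tCoeff j p w)
... | false = trans (pair-tCoeff j p w)
  (sym (trans (cong (λ z → z ℤ.+ ⟪ p ∣ atTDegree j w ⟫) (ℤP.*-zeroʳ c)) (ℤP.+-identityˡ _)))

tCoeff-cong : ∀ j {p q : Poly (suc n)} → p ≃ q → tCoeff j p ≃ tCoeff j q
tCoeff-cong j {p} {q} p≃q = mk≃ λ w →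
  trans (pair-tCoeff j p w) (trans (pair-≡ p≃q _) (sym (pair-tCoeff j q w)))

tCoeff-+P : ∀ j (p q : Poly (suc n)) → tCoeff j (p +P q) ≃ tCoeff j p +P tCoeff j q
tCoeff-+P j p q = mk≃ λ w → trans (pair-tCoeff j (p +P q) w) (trans (pair-+P p q _)
  (sym (trans (pair-+P (tCoeff j p) (tCoeff j q) w) (cong₂ ℤ._+_ (pair-tCoeff j p w) (pair-tCoeff j q w)))))

tCoeff-negP : ∀ j (p : Poly (suc n)) → tCoeff j (negP p) ≃ negP (tCoeff j p)
tCoeff-negP j p = mk≃ λ w → trans (pair-tCoeff j (negP p) w) (trans (pair-negP p _)
  (sym (trans (pair-negP (tCoeff j p) w) (cong ℤ.-_ (pair-tCoeff j p w)))))

tCoeff-embed-*P : ∀ j (u : Poly n) (p : Poly (suc n)) → tCoeff j (embed u *P p) ≃ u *P tCoeff j p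
tCoeff-embed-*P j u p = mk≃ λ w →
  trans (pair-tCoeff j (embed u *P p) w)
  (trans (pair-*P (embed u) p _)
  (trans (pair-embed u _)
  (sym (trans (pair-*P u (tCoeff j p) w)
    (pair-cong u (λ a → trans (pair-tCoeff j p _) (pair-cong p (λ { (e ∷ es) → refl }))))))))

tCoeff-tVar-*P : ∀ j (p : Poly (suc n)) → tCoeff (suc j) (tVar *P p) ≃ tCoeff j p
tCoeff-tVar-*P j p = mk≃ λ w →
  trans (pair-tCoeff (suc j) (tVar *P p) w)
  (trans (pair-*P tVar p _)
  (trans (pair-tVar (λ a → ⟪ p ∣ (λ b → atTDegree (suc j) w (a ⊕ b)) ⟫))
  (trans (pair-cong p λ { (e ∷ es) → cong (λ z → if e ℕ.≡ᵇ j then w z else 0ℤ) (⊕-identityˡ es) })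
  (sym (pair-tCoeff j p w)))))

tCoeff-embed-zero : ∀ (u : Poly n) → tCoeff 0 (embed u) ≃ u
tCoeff-embed-zero u = mk≃ λ w → trans (pair-tCoeff 0 (embed u) w) (pair-embed u _)

tCoeff-embed-suc : ∀ j (u : Poly n) → tCoeff (suc j) (embed u) ≃ zeroP
tCoeff-embed-suc j u = mk≃ λ w →
  trans (pair-tCoeff (suc j) (embed u) w) (trans (pair-embed u _) (pair-0ʷ u))

monomialImage : (Fin n → Poly m) → Monomial n → Poly m
monomialImage {n} σ k = foldr (λ i acc → powP (σ i) (lookup k i) *P acc) oneP (allFin n)

monomialImage-∷ : ∀ (σ : Fin (suc n) → Poly m) k₀ k →
                  monomialImage σ (k₀ ∷ k) ≡ powP (σ zero) k₀ *P monomialImage (σ ∘ suc) k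
monomialImage-∷ {n} σ k₀ k = cong (powP (σ zero) k₀ *P_)
  (trans (cong (foldr step oneP) (sym (map-tabulate (λ i → i) Fin.suc))) (foldr-map step Fin.suc oneP (allFin n)))
  where
  step : Fin (suc n) → Poly _ → Poly _
  step i acc = powP (σ i) (lookup (k₀ ∷ k) i) *P acc

pair-substP : ∀ (σ : Fin n → Poly m) p w →
              ⟪ substP σ p ∣ w ⟫ ≡ ⟪ p ∣ (λ k → ⟪ monomialImage σ k ∣ w ⟫) ⟫
pair-substP σ [] w = refl
pair-substP σ ((c , k) ∷ p) w =
  trans (pair-+P (scaleP c (monomialImage σ k)) (substP σ p) w)
        (cong₂ ℤ._+_ (pair-scaleP c (monomialImage σ k) w) (pair-substP σ p w))

substP-cong : ∀ (σ : Fin n → Poly m) {p q} → p ≃ q → substP σ p ≃ substP σ q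
substP-cong σ {p} {q} p≃q = mk≃ λ w →
  trans (pair-substP σ p w) (trans (pair-≡ p≃q _) (sym (pair-substP σ q w)))

substP-+P : ∀ (σ : Fin n → Poly m) p q → substP σ (p +P q) ≃ substP σ p +P substP σ q
substP-+P σ p q = mk≃ λ w → trans (pair-substP σ (p +P q) w) (trans (pair-+P p q _)
  (sym (trans (pair-+P (substP σ p) (substP σ q) w) (cong₂ ℤ._+_ (pair-substP σ p w) (pair-substP σ q w)))))

substP-negP : ∀ (σ : Fin n → Poly m) p → substP σ (negP p) ≃ negP (substP σ p)
substP-negP σ p = mk≃ λ w → trans (pair-substP σ (negP p) w) (trans (pair-negP p _)
  (sym (trans (pair-negP (substP σ p) w) (cong ℤ.-_ (pair-substP σ p w)))))

substP--P : ∀ (σ : Fin n → Poly m) p q → substP σ (p -P q) ≃ substP σ p -P substP σ q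
substP--P σ p q = ≃-trans (substP-+P σ p (negP q)) (+P-cong ≃-refl (substP-negP σ q))

powP-+ : ∀ (x : Poly m) a b → powP x (a + b) ≃ powP x a *P powP x b
powP-+ x zero b = ≃-sym (*P-identityˡ (powP x b))
powP-+ x (suc a) b =
  ≃-trans (*P-cong (≃-refl {p = x}) (powP-+ x a b)) (≃-sym (*P-assoc x (powP x a) (powP x b)))

monomialImage-⊕ : ∀ (σ : Fin n → Poly m) a b →
                  monomialImage σ (a ⊕ b) ≃ monomialImage σ a *P monomialImage σ b
monomialImage-⊕ σ [] [] = ≃-sym (*P-identityˡ oneP)
monomialImage-⊕ {m = m} σ (x ∷ a) (y ∷ b) = begin
  monomialImage σ ((x + y) ∷ (a ⊕ b))
    ≡⟨ monomialImage-∷ σ (x + y) (a ⊕ b) ⟩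
  powP s (x + y) *P monomialImage (σ ∘ suc) (a ⊕ b)
    ≈⟨ *P-cong (powP-+ s x y) (monomialImage-⊕ (σ ∘ suc) a b) ⟩
  (powP s x *P powP s y) *P (monomialImage (σ ∘ suc) a *P monomialImage (σ ∘ suc) b)
    ≈⟨ solve 4 (λ p q r t → (p :* q) :* (r :* t) := (p :* r) :* (q :* t)) ≃-refl
         (powP s x) (powP s y) (monomialImage (σ ∘ suc) a) (monomialImage (σ ∘ suc) b) ⟩
  (powP s x *P monomialImage (σ ∘ suc) a) *P (powP s y *P monomialImage (σ ∘ suc) b)
    ≡⟨ sym (cong₂ _*P_ (monomialImage-∷ σ x a) (monomialImage-∷ σ y b)) ⟩
  monomialImage σ (x ∷ a) *P monomialImage σ (y ∷ b) ∎
  where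
  open PolySolver m
  s = σ zero

monomialImage-0 : ∀ (σ : Fin n → Poly m) → monomialImage σ (replicate n 0) ≃ oneP
monomialImage-0 {zero} σ = ≃-refl
monomialImage-0 {suc n} σ =
  ≃-trans (≡⇒≃ (monomialImage-∷ σ 0 (replicate n 0)))
  (≃-trans (*P-identityˡ _) (monomialImage-0 (σ ∘ suc)))

substP-*P : ∀ (σ : Fin n → Poly m) p q → substP σ (p *P q) ≃ substP σ p *P substP σ q
substP-*P σ p q = mk≃ λ w → begin
  ⟪ substP σ (p *P q) ∣ w ⟫
    ≡⟨ trans (pair-substP σ (p *P q) w) (pair-*P p q _) ⟩
  ⟪ p ∣ (λ a → ⟪ q ∣ (λ b → ⟪ monomialImage σ (a ⊕ b) ∣ w ⟫) ⟫) ⟫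
    ≡⟨ pair-cong p (λ a → pair-cong q (λ b →
         trans (pair-≡ (monomialImage-⊕ σ a b) w) (pair-*P (monomialImage σ a) (monomialImage σ b) w))) ⟩
  ⟪ p ∣ (λ a → ⟪ q ∣ (λ b →
    ⟪ monomialImage σ a ∣ (λ c → ⟪ monomialImage σ b ∣ (λ d → w (c ⊕ d)) ⟫) ⟫) ⟫) ⟫
    ≡⟨ pair-cong p (λ a → sym (trans (pair-cong (monomialImage σ a) (λ _ → pair-substP σ q _))
                                      (pair-swap (monomialImage σ a) q _))) ⟩
  ⟪ p ∣ (λ a → ⟪ monomialImage σ a ∣ (λ c → ⟪ substP σ q ∣ (λ d → w (c ⊕ d)) ⟫) ⟫) ⟫
    ≡⟨ sym (trans (pair-*P (substP σ p) (substP σ q) w) (pair-substP σ p _)) ⟩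
  ⟪ substP σ p *P substP σ q ∣ w ⟫ ∎
  where open ≡-Reasoning

substP-oneP : ∀ (σ : Fin n → Poly m) → substP σ oneP ≃ oneP
substP-oneP σ = mk≃ λ w →
  trans (pair-substP σ oneP w)
        (trans (pair-oneP (λ k → ⟪ monomialImage σ k ∣ w ⟫)) (pair-≡ (monomialImage-0 σ) w))

unitMonomial : Fin n → Monomial n
unitMonomial {suc n} zero = 1 ∷ replicate n 0
unitMonomial (suc i) = 0 ∷ unitMonomial i

pair-varP : ∀ (i : Fin n) w → ⟪ varP i ∣ w ⟫ ≡ w (unitMonomial i)
pair-varP zero w = pair-tVar w
pair-varP (suc i) w = trans (pair-renameMonomials _ (0 ∷_) (λ _ _ → refl) (varP i) w) (pair-varP i _)

monomialImage-unit : ∀ (σ : Fin n → Poly m) i → monomialImage σ (unitMonomial i) ≃ σ i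
monomialImage-unit {suc n} σ zero =
  ≃-trans (≡⇒≃ (monomialImage-∷ σ 1 (replicate n 0)))
  (≃-trans (*P-cong (*P-identityʳ (σ zero)) (monomialImage-0 (σ ∘ suc))) (*P-identityʳ (σ zero)))
monomialImage-unit σ (suc i) =
  ≃-trans (≡⇒≃ (monomialImage-∷ σ 0 (unitMonomial i)))
  (≃-trans (*P-identityˡ _) (monomialImage-unit (σ ∘ suc) i))

substP-varP : ∀ (σ : Fin n → Poly m) i → substP σ (varP i) ≃ σ i
substP-varP σ i = mk≃ λ w →
  trans (pair-substP σ (varP i) w) (trans (pair-varP i _) (pair-≡ (monomialImage-unit σ i) w))

-- Evaluation at integer points

evalMonomial : (Fin n → ℤ) → Monomial n → ℤ
evalMonomial x [] = 1ℤ
evalMonomial x (k ∷ ks) = x zero ℤ.^ k ℤ.* evalMonomial (x ∘ suc) ks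

eval : (Fin n → ℤ) → Poly n → ℤ
eval x p = ⟪ p ∣ evalMonomial x ⟫

evalMonomial-⊕ : ∀ (x : Fin n → ℤ) a b →
                 evalMonomial x (a ⊕ b) ≡ evalMonomial x a ℤ.* evalMonomial x b
evalMonomial-⊕ x [] [] = refl
evalMonomial-⊕ x (i ∷ a) (j ∷ b) =
  trans (cong₂ ℤ._*_ (ℤP.^-distribˡ-+-* (x zero) i j) (evalMonomial-⊕ (x ∘ suc) a b))
        (ℤ*.interchange (x zero ℤ.^ i) (x zero ℤ.^ j) _ _)

evalMonomial-0 : ∀ (x : Fin n → ℤ) → evalMonomial x (replicate n 0) ≡ 1ℤ
evalMonomial-0 {zero} x = refl
evalMonomial-0 {suc n} x = trans (ℤP.*-identityˡ _) (evalMonomial-0 (x ∘ suc))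

evalMonomial-unit : ∀ (x : Fin n → ℤ) i → evalMonomial x (unitMonomial i) ≡ x i
evalMonomial-unit x zero =
  trans (cong (x zero ℤ.^ 1 ℤ.*_) (evalMonomial-0 (x ∘ suc)))
        (trans (ℤP.*-identityʳ _) (ℤP.^-identityʳ (x zero)))
evalMonomial-unit x (suc i) = trans (ℤP.*-identityˡ _) (evalMonomial-unit (x ∘ suc) i)

eval-*P : ∀ (x : Fin n → ℤ) p q → eval x (p *P q) ≡ eval x p ℤ.* eval x q
eval-*P x p q = begin
  eval x (p *P q)
    ≡⟨ pair-*P p q _ ⟩
  ⟪ p ∣ (λ a → ⟪ q ∣ (λ b → evalMonomial x (a ⊕ b)) ⟫) ⟫
    ≡⟨ pair-cong p (λ a → trans (pair-cong q (evalMonomial-⊕ x a))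
                                (pair-*ʷ q (evalMonomial x a) (evalMonomial x))) ⟩
  ⟪ p ∣ (λ a → evalMonomial x a ℤ.* eval x q) ⟫
    ≡⟨ pair-cong p (λ a → ℤP.*-comm (evalMonomial x a) _) ⟩
  ⟪ p ∣ (λ a → eval x q ℤ.* evalMonomial x a) ⟫
    ≡⟨ trans (pair-*ʷ p (eval x q) (evalMonomial x)) (ℤP.*-comm (eval x q) _) ⟩
  eval x p ℤ.* eval x q ∎
  where open ≡-Reasoning

eval-varP : ∀ (x : Fin n → ℤ) i → eval x (varP i) ≡ x i
eval-varP x i = trans (pair-varP i (evalMonomial x)) (evalMonomial-unit x i)

eval-oneP : ∀ (x : Fin n → ℤ) → eval x oneP ≡ 1ℤ
eval-oneP x = trans (pair-oneP (evalMonomial x)) (evalMonomial-0 x)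

eval--P : ∀ (x : Fin n → ℤ) p q → eval x (p -P q) ≡ eval x p ℤ.- eval x q
eval--P x p q =
  trans (pair-+P p (negP q) (evalMonomial x)) (cong (ℤ._+_ (eval x p)) (pair-negP q (evalMonomial x)))

dropMonomial : Monomial n → Poly n → Poly n
dropMonomial m [] = []
dropMonomial m ((c , k) ∷ p) with ≡-dec ℕ._≟_ k m
... | yes _ = dropMonomial m p
... | no _ = (c , k) ∷ dropMonomial m p

length-dropMonomial : ∀ (m : Monomial n) p → length (dropMonomial m p) ≤ length p
length-dropMonomial m [] = z≤n
length-dropMonomial m ((c , k) ∷ p) with ≡-dec ℕ._≟_ k m
... | yes _ = ℕP.m≤n⇒m≤1+n (length-dropMonomial m p)
... | no _ = s≤s (length-dropMonomial m p)

pair-dropMonomial : ∀ (m : Monomial n) p w →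
                    ⟪ p ∣ w ⟫ ≡ coeff p m ℤ.* w m ℤ.+ ⟪ dropMonomial m p ∣ w ⟫
pair-dropMonomial m [] w = sym (ℤP.+-identityʳ (0ℤ ℤ.* w m))
pair-dropMonomial m ((c , k) ∷ p) w with ≡-dec ℕ._≟_ k m
... | yes refl = trans (cong (ℤ._+_ (c ℤ.* w k)) (pair-dropMonomial k p w)) (begin
    c ℤ.* w k ℤ.+ (coeff p k ℤ.* w k ℤ.+ r) ≡⟨ sym (ℤP.+-assoc (c ℤ.* w k) _ r) ⟩
    c ℤ.* w k ℤ.+ coeff p k ℤ.* w k ℤ.+ r   ≡⟨ cong (ℤ._+ r) (sym (ℤP.*-distribʳ-+ (w k) c _)) ⟩
    (c ℤ.+ coeff p k) ℤ.* w k ℤ.+ r         ∎)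
  where
  open ≡-Reasoning
  r = ⟪ dropMonomial k p ∣ w ⟫
... | no _ = trans (cong (ℤ._+_ (c ℤ.* w k)) (pair-dropMonomial m p w))
                   (ℤ+.x∙yz≈y∙xz (c ℤ.* w k) (coeff p m ℤ.* w m) ⟪ dropMonomial m p ∣ w ⟫)

coeff-∷-≢ : ∀ c (k m : Monomial n) p → k ≢ m → coeff ((c , k) ∷ p) m ≡ coeff p m
coeff-∷-≢ c k m p k≢m with ≡-dec ℕ._≟_ k m
... | yes k≡m = contradiction k≡m k≢m
... | no _ = refl

dropMonomial-∷-self : ∀ c (k : Monomial n) p → dropMonomial k ((c , k) ∷ p) ≡ dropMonomial k p
dropMonomial-∷-self c k p with ≡-dec ℕ._≟_ k k
... | yes _ = refl
... | no k≢k = contradiction refl k≢k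

coeff-dropMonomial-self : ∀ (m : Monomial n) p → coeff (dropMonomial m p) m ≡ 0ℤ
coeff-dropMonomial-self m [] = refl
coeff-dropMonomial-self m ((c , k) ∷ p) with ≡-dec ℕ._≟_ k m
... | yes _ = coeff-dropMonomial-self m p
... | no k≢m = trans (coeff-∷-≢ c k m (dropMonomial m p) k≢m) (coeff-dropMonomial-self m p)

coeff-dropMonomial-other : ∀ (m m′ : Monomial n) p → m′ ≢ m →
                           coeff (dropMonomial m p) m′ ≡ coeff p m′
coeff-dropMonomial-other m m′ [] _ = refl
coeff-dropMonomial-other m m′ ((c , k) ∷ p) m′≢m with ≡-dec ℕ._≟_ k m
... | yes refl =
  trans (coeff-dropMonomial-other m m′ p m′≢m) (sym (coeff-∷-≢ c k m′ p (m′≢m ∘ sym)))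
... | no _ with ≡-dec ℕ._≟_ k m′
...   | yes _ = cong (ℤ._+_ c) (coeff-dropMonomial-other m m′ p m′≢m)
...   | no _ = coeff-dropMonomial-other m m′ p m′≢m

IsZeroP-dropMonomial : ∀ c (k : Monomial n) p → IsZeroP ((c , k) ∷ p) → IsZeroP (dropMonomial k p)
IsZeroP-dropMonomial c k p zero-p m′ with ≡-dec ℕ._≟_ m′ k
... | yes refl = trans (cong (λ q → coeff q m′) (sym (dropMonomial-∷-self c k p)))
                       (coeff-dropMonomial-self k ((c , k) ∷ p))
... | no m′≢k = trans (cong (λ q → coeff q m′) (sym (dropMonomial-∷-self c k p)))
                      (trans (coeff-dropMonomial-other k m′ ((c , k) ∷ p) m′≢k) (zero-p m′))

IsZeroP⇒pair≡0 : ∀ (p : Poly n) → IsZeroP p → ∀ w → ⟪ p ∣ w ⟫ ≡ 0ℤ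
IsZeroP⇒pair≡0 p = go (length p) p ℕP.≤-refl
  where
  go : ∀ bound (p : Poly n) → length p ≤ bound → IsZeroP p → ∀ w → ⟪ p ∣ w ⟫ ≡ 0ℤ
  go _ [] _ _ w = refl
  go (suc bound) ((c , k) ∷ p) (s≤s len≤) zero-p w = begin
    ⟪ (c , k) ∷ p ∣ w ⟫
      ≡⟨ pair-dropMonomial k ((c , k) ∷ p) w ⟩
    coeff ((c , k) ∷ p) k ℤ.* w k ℤ.+ ⟪ dropMonomial k ((c , k) ∷ p) ∣ w ⟫
      ≡⟨ cong₂ (λ a q → a ℤ.* w k ℤ.+ ⟪ q ∣ w ⟫) (zero-p k) (dropMonomial-∷-self c k p) ⟩
    0ℤ ℤ.* w k ℤ.+ ⟪ dropMonomial k p ∣ w ⟫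
      ≡⟨ ℤP.+-identityˡ _ ⟩
    ⟪ dropMonomial k p ∣ w ⟫
      ≡⟨ go bound (dropMonomial k p) (ℕP.≤-trans (length-dropMonomial k p) len≤)
            (IsZeroP-dropMonomial c k p zero-p) w ⟩
    0ℤ ∎
    where open ≡-Reasoning

<ᵇ≡true⇒< : ∀ {m n} → (m ℕ.<ᵇ n) ≡ true → m < n
<ᵇ≡true⇒< {m} {n} eq = ℕP.<ᵇ⇒< m n (subst IsTrue (sym eq) tt)

<ᵇ≡false⇒≥ : ∀ {m n} → (m ℕ.<ᵇ n) ≡ false → n ≤ m
<ᵇ≡false⇒≥ eq = ℕP.≮⇒≥ (λ m<n → subst IsTrue eq (ℕP.<⇒<ᵇ m<n))

<⇒<ᵇ≡true : ∀ {m n} → m < n → (m ℕ.<ᵇ n) ≡ true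
<⇒<ᵇ≡true {m} {n} m<n with m ℕ.<ᵇ n in eq
... | true = refl
... | false = contradiction m<n (ℕP.≤⇒≯ (<ᵇ≡false⇒≥ eq))

≥⇒<ᵇ≡false : ∀ {m n} → n ≤ m → (m ℕ.<ᵇ n) ≡ false
≥⇒<ᵇ≡false {m} {n} n≤m with m ℕ.<ᵇ n in eq
... | true = contradiction n≤m (ℕP.<⇒≱ (<ᵇ≡true⇒< eq))
... | false = refl

+-<ᵇ : ∀ a i j → (a + j ℕ.<ᵇ a + i) ≡ (j ℕ.<ᵇ i)
+-<ᵇ zero i j = refl
+-<ᵇ (suc a) i j = +-<ᵇ a i j

∈-range1⁻ : ∀ {i r} → i ∈ range1 r → ∃[ k ] i ≡ suc k × k < r
∈-range1⁻ i∈range with ∈-map⁻ suc i∈range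
... | k , k∈upTo , refl = k , refl , ∈-upTo⁻ k∈upTo

length-range1 : ∀ r → length (range1 r) ≡ r
length-range1 r = trans (length-map suc (upTo r)) (length-upTo r)

applyUpTo-+ : {A : Set} (f : ℕ → A) (a b : ℕ) →
              applyUpTo f (a + b) ≡ applyUpTo f a ++ applyUpTo (f ∘ (a +_)) b
applyUpTo-+ f zero b = refl
applyUpTo-+ f (suc a) b = cong (f 0 ∷_) (applyUpTo-+ (f ∘ suc) a b)

range1-+ : ∀ a b → range1 (a + b) ≡ range1 a ++ map (a +_) (range1 b)
range1-+ a b = begin
  map suc (upTo (a + b))
    ≡⟨ cong (map suc) (trans (applyUpTo-+ (λ i → i) a b) (cong (upTo a ++_) (sym (map-upTo (a +_) b)))) ⟩
  map suc (upTo a ++ map (a +_) (upTo b))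
    ≡⟨ map-++ suc (upTo a) _ ⟩
  range1 a ++ map suc (map (a +_) (upTo b))
    ≡⟨ cong (range1 a ++_) (trans (sym (map-∘ (upTo b)))
                           (trans (map-cong (λ i → sym (ℕP.+-suc a i)) (upTo b)) (map-∘ (upTo b)))) ⟩
  range1 a ++ map (a +_) (range1 b) ∎
  where open ≡-Reasoning

Unique-++⇒disjoint : ∀ (xs : List ℕ) {ys x} → Unique (xs ++ ys) → x ∈ xs → x ∈ ys → ⊥
Unique-++⇒disjoint (_ ∷ xs) (x∉ ∷ _) (here refl) x∈ys = All.lookup x∉ (∈-++⁺ʳ xs x∈ys) refl
Unique-++⇒disjoint (_ ∷ xs) (_ ∷ unique) (there x∈xs) x∈ys = Unique-++⇒disjoint xs unique x∈xs x∈ys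

X≡varP : ∀ n i (k : Fin n) → toℕ k ≡ i ∸ 1 → X n i ≡ varP k
X≡varP n i k toℕk≡i-1 with (i ∸ 1) ℕ.<? n
... | yes i-1<n = cong varP (toℕ-injective (trans (toℕ-fromℕ< i-1<n) (sym toℕk≡i-1)))
... | no i-1≮n = contradiction (subst (_< n) toℕk≡i-1 (toℕ<n k)) i-1≮n

∏ : {A : Set} → List A → (A → Poly n) → Poly n
∏ [] h = oneP
∏ (x ∷ xs) h = h x *P ∏ xs h

sumOver : {A : Set} → List A → (A → ℕ) → ℕ
sumOver [] d = 0
sumOver (x ∷ xs) d = d x + sumOver xs d

sumOver-++ : {A : Set} (xs ys : List A) (d : A → ℕ) → sumOver (xs ++ ys) d ≡ sumOver xs d + sumOver ys d
sumOver-++ [] ys d = refl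
sumOver-++ (x ∷ xs) ys d = trans (cong (d x +_) (sumOver-++ xs ys d)) (sym (ℕP.+-assoc (d x) _ _))

sumOver-const : {A : Set} (xs : List A) (d : A → ℕ) (c : ℕ) → (∀ {x} → x ∈ xs → d x ≡ c) →
                sumOver xs d ≡ length xs * c
sumOver-const [] d c _ = refl
sumOver-const (x ∷ xs) d c d≡c = cong₂ _+_ (d≡c (here refl)) (sumOver-const xs d c (d≡c ∘ there))

∏-cong : {A : Set} (xs : List A) {h h′ : A → Poly n} → (∀ {x} → x ∈ xs → h x ≃ h′ x) →
         ∏ xs h ≃ ∏ xs h′
∏-cong [] _ = ≃-refl
∏-cong (x ∷ xs) h≃h′ = *P-cong (h≃h′ (here refl)) (∏-cong xs (h≃h′ ∘ there))

∏-++ : {A : Set} (xs ys : List A) (h : A → Poly n) → ∏ (xs ++ ys) h ≃ ∏ xs h *P ∏ ys h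
∏-++ [] ys h = ≃-sym (*P-identityˡ (∏ ys h))
∏-++ (x ∷ xs) ys h =
  ≃-trans (*P-cong (≃-refl {p = h x}) (∏-++ xs ys h)) (≃-sym (*P-assoc (h x) (∏ xs h) (∏ ys h)))

∏-map : {A B : Set} (g : A → B) (xs : List A) (h : B → Poly n) → ∏ (map g xs) h ≡ ∏ xs (h ∘ g)
∏-map g [] h = refl
∏-map g (x ∷ xs) h = cong (h (g x) *P_) (∏-map g xs h)

∏-≃oneP : {A : Set} (xs : List A) (h : A → Poly n) → (∀ {x} → x ∈ xs → h x ≃ oneP) →
          ∏ xs h ≃ oneP
∏-≃oneP [] h _ = ≃-refl
∏-≃oneP (x ∷ xs) h h≃1 =
  ≃-trans (*P-cong (h≃1 (here refl)) (∏-≃oneP xs h (h≃1 ∘ there))) (*P-identityˡ oneP)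

prodP-concatMap : {A : Set} (g : A → List (Poly n)) (xs : List A) →
                  prodP (concatMap g xs) ≃ ∏ xs (λ x → prodP (g x))
prodP-concatMap g [] = ≃-refl
prodP-concatMap g (x ∷ xs) = ≃-trans (prodP-++ (g x) (concatMap g xs))
                                     (*P-cong (≃-refl {p = prodP (g x)}) (prodP-concatMap g xs))
  where
  prodP-++ : ∀ (ps qs : List (Poly _)) → prodP (ps ++ qs) ≃ prodP ps *P prodP qs
  prodP-++ [] qs = ≃-sym (*P-identityˡ (prodP qs))
  prodP-++ (p ∷ ps) qs =
    ≃-trans (*P-cong (≃-refl {p = p}) (prodP-++ ps qs)) (≃-sym (*P-assoc p (prodP ps) (prodP qs)))

substP-∏ : {A : Set} (σ : Fin n → Poly m) (xs : List A) (h : A → Poly n) →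
           substP σ (∏ xs h) ≃ ∏ xs (substP σ ∘ h)
substP-∏ σ [] h = substP-oneP σ
substP-∏ σ (x ∷ xs) h =
  ≃-trans (substP-*P σ (h x) (∏ xs h)) (*P-cong (≃-refl {p = substP σ (h x)}) (substP-∏ σ xs h))

eval-∏≢0 : {A : Set} (x : Fin n → ℤ) (xs : List A) (h : A → Poly n) →
           (∀ {a} → a ∈ xs → eval x (h a) ≢ 0ℤ) → eval x (∏ xs h) ≢ 0ℤ
eval-∏≢0 x [] h _ eq = contradiction (trans (sym (eval-oneP x)) eq) λ ()
eval-∏≢0 x (a ∷ xs) h ≢0 eq
  with ℤP.i*j≡0⇒i≡0∨j≡0 (eval x (h a)) (trans (sym (eval-*P x (h a) (∏ xs h))) eq)
... | inj₁ ha≡0 = ≢0 (here refl) ha≡0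
... | inj₂ rest≡0 = eval-∏≢0 x xs h (≢0 ∘ there) rest≡0

differenceFactor : (n : ℕ) → ℕ → ℕ → Poly n
differenceFactor n i j = if j ℕ.<ᵇ i then X n i -P X n j else oneP

differenceProduct : (n : ℕ) → List ℕ → Poly n
differenceProduct n S = ∏ S (λ i → ∏ S (differenceFactor n i))

Δ≃differenceProduct : ∀ n S → Δ n S ≃ differenceProduct n S
Δ≃differenceProduct n S =
  ≃-trans (prodP-concatMap _ S) (∏-cong S (λ {i} _ →
  ≃-trans (prodP-concatMap _ S) (∏-cong S (λ {j} _ → prodP-if (j ℕ.<ᵇ i) (X n i -P X n j)))))
  where
  prodP-if : ∀ b (p : Poly n) → prodP (if b then p ∷ [] else []) ≃ (if b then p else oneP)
  prodP-if true p = *P-identityʳ p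
  prodP-if false p = ≃-refl

substP-differenceProduct : ∀ (τ : Fin m → Poly n) (h : ℕ → ℕ) S →
  (∀ {i} → i ∈ S → substP τ (X m i) ≃ X n (h i)) →
  (∀ i j → (h j ℕ.<ᵇ h i) ≡ (j ℕ.<ᵇ i)) →
  substP τ (differenceProduct m S) ≃ differenceProduct n (map h S)
substP-differenceProduct {m} {n} τ h S τX h-<ᵇ =
  ≃-trans (substP-∏ τ S _)
  (≃-trans (∏-cong S (λ {i} i∈S → ≃-trans (substP-∏ τ S (differenceFactor m i))
                                  (∏-cong S (λ {j} j∈S → factor i∈S j∈S))))
  (≃-sym (≃-trans (≡⇒≃ (∏-map h S _))
                  (∏-cong S (λ {i} _ → ≡⇒≃ (∏-map h S (differenceFactor n (h i))))))))
  where
  factor : ∀ {i j} → i ∈ S → j ∈ S → substP τ (differenceFactor m i j) ≃ differenceFactor n (h i) (h j)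
  factor {i} {j} i∈S j∈S rewrite h-<ᵇ i j with j ℕ.<ᵇ i
  ... | true = ≃-trans (substP--P τ (X m i) (X m j)) (+P-cong (τX i∈S) (negP-cong (τX j∈S)))
  ... | false = substP-oneP τ

-- Leading terms in t

record LeadingTerm (p : Poly (suc n)) (d : ℕ) (a : Poly n) : Set where
  constructor leadingTerm
  field
    leading : tCoeff d p ≃ a
    vanishes-above : ∀ j → d < j → tCoeff j p ≃ zeroP
open LeadingTerm public

LeadingTerm-cong : ∀ {p p′ : Poly (suc n)} {d a a′} → p ≃ p′ → a ≃ a′ →
                   LeadingTerm p d a → LeadingTerm p′ d a′
LeadingTerm-cong {d = d} p≃p′ a≃a′ lt = leadingTerm
  (≃-trans (tCoeff-cong d (≃-sym p≃p′)) (≃-trans (leading lt) a≃a′))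
  (λ j d<j → ≃-trans (tCoeff-cong j (≃-sym p≃p′)) (vanishes-above lt j d<j))

-- The t-coefficients of a product are convolutions, so instead of a general
-- product rule a factor is described by what multiplying by it does to the
-- leading term of an arbitrary cofactor; this is immediate for t-free and for
-- monic linear factors, and composes under products.
record ShiftsLeadingTerm (p : Poly (suc n)) (d : ℕ) (a : Poly n) : Set where
  constructor shiftsLeadingTerm
  field shift : ∀ q e b → LeadingTerm q e b → LeadingTerm (p *P q) (d + e) (a *P b)
open ShiftsLeadingTerm public

ShiftsLeadingTerm-cong : ∀ {p p′ : Poly (suc n)} {d a a′} → p ≃ p′ → a ≃ a′ →
                         ShiftsLeadingTerm p d a → ShiftsLeadingTerm p′ d a′
ShiftsLeadingTerm-cong p≃p′ a≃a′ s = shiftsLeadingTerm λ q e b lt →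
  LeadingTerm-cong (*P-cong p≃p′ ≃-refl) (*P-cong a≃a′ ≃-refl) (shift s q e b lt)

embed-shiftsLeadingTerm : ∀ (u : Poly n) → ShiftsLeadingTerm (embed u) 0 u
embed-shiftsLeadingTerm u = shiftsLeadingTerm λ q e b lt → leadingTerm
  (≃-trans (tCoeff-embed-*P e u q) (*P-cong (≃-refl {p = u}) (leading lt)))
  (λ j e<j → ≃-trans (tCoeff-embed-*P j u q)
                (≃-trans (*P-cong (≃-refl {p = u}) (vanishes-above lt j e<j)) (*P-zeroʳ u)))

embed+tVar-shiftsLeadingTerm : ∀ (u : Poly n) → ShiftsLeadingTerm (embed u +P tVar) 1 oneP
embed+tVar-shiftsLeadingTerm u = shiftsLeadingTerm λ q e b lt → leadingTerm
  (≃-trans (tCoeff-split q e (vanishes-above lt (suc e) (ℕP.n<1+n e)))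
           (≃-trans (leading lt) (≃-sym (*P-identityˡ b))))
  λ { (suc j) (s≤s e<j) →
      ≃-trans (tCoeff-split q j (vanishes-above lt (suc j) (ℕP.m<n⇒m<1+n e<j))) (vanishes-above lt j e<j) }
  where
  -- the coefficient of t^(j+1) in (u + t) q is u q_(j+1) + q_j
  tCoeff-split : ∀ q j → tCoeff (suc j) q ≃ zeroP → tCoeff (suc j) ((embed u +P tVar) *P q) ≃ tCoeff j q
  tCoeff-split q j q₊≃0 =
    ≃-trans (tCoeff-cong (suc j) (*P-distribʳ-+P q (embed u) tVar))
    (≃-trans (tCoeff-+P (suc j) (embed u *P q) (tVar *P q))
    (≃-trans (+P-cong (≃-trans (tCoeff-embed-*P (suc j) u q)
                               (≃-trans (*P-cong (≃-refl {p = u}) q₊≃0) (*P-zeroʳ u)))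
                      (tCoeff-tVar-*P j q))
             (+P-identityˡ (tCoeff j q))))

*P-shiftsLeadingTerm : ∀ {p p′ : Poly (suc n)} {d d′ a a′} →
                       ShiftsLeadingTerm p d a → ShiftsLeadingTerm p′ d′ a′ →
                       ShiftsLeadingTerm (p *P p′) (d + d′) (a *P a′)
*P-shiftsLeadingTerm {p = p} {p′} {d} {d′} {a} {a′} s s′ = shiftsLeadingTerm λ q e b lt →
  subst (λ k → LeadingTerm ((p *P p′) *P q) k ((a *P a′) *P b)) (sym (ℕP.+-assoc d d′ e))
    (LeadingTerm-cong (≃-sym (*P-assoc p p′ q)) (≃-sym (*P-assoc a a′ b))
      (shift s (p′ *P q) (d′ + e) (a′ *P b) (shift s′ q e b lt)))

∏-shiftsLeadingTerm : {A : Set} (xs : List A) (h : A → Poly (suc n)) (d : A → ℕ) (a : A → Poly n) →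
                      (∀ {x} → x ∈ xs → ShiftsLeadingTerm (h x) (d x) (a x)) →
                      ShiftsLeadingTerm (∏ xs h) (sumOver xs d) (∏ xs a)
∏-shiftsLeadingTerm [] h d a _ = shiftsLeadingTerm λ q e b lt →
  LeadingTerm-cong (≃-sym (*P-identityˡ q)) (≃-sym (*P-identityˡ b)) lt
∏-shiftsLeadingTerm (x ∷ xs) h d a s =
  *P-shiftsLeadingTerm (s (here refl)) (∏-shiftsLeadingTerm xs h d a (s ∘ there))

shiftsLeadingTerm⇒LeadingTerm : ∀ {p : Poly (suc n)} {d a} → ShiftsLeadingTerm p d a → LeadingTerm p d a
shiftsLeadingTerm⇒LeadingTerm {p = p} {d} {a} s =
  subst (λ k → LeadingTerm p k a) (ℕP.+-identityʳ d)
    (LeadingTerm-cong (*P-identityʳ p) (*P-identityʳ a) (shift s oneP 0 oneP oneP-leadingTerm))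
  where
  oneP-leadingTerm : LeadingTerm oneP 0 oneP
  oneP-leadingTerm = leadingTerm (tCoeff-embed-zero oneP) λ { (suc j) _ → tCoeff-embed-suc j oneP }

chain : (ℕ → Poly n) → List ℕ → Poly n
chain h (x ∷ y ∷ e) = (h x -P h y) *P chain h (y ∷ e)
chain h _ = oneP

ψ′≡chain : ∀ n xs → ψ' n xs ≡ chain (X n) xs
ψ′≡chain n [] = refl
ψ′≡chain n (x ∷ []) = refl
ψ′≡chain n (x ∷ y ∷ xs) = cong ((X n x -P X n y) *P_) (ψ′≡chain n (y ∷ xs))

lastOr-++ : ∀ d (xs : List ℕ) y ys → lastOr d (xs ++ y ∷ ys) ≡ lastOr y ys
lastOr-++ d [] y ys = refl
lastOr-++ d (x ∷ xs) y ys = lastOr-++ x xs y ys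

lastOr-∈ : ∀ d (xs : List ℕ) → lastOr d xs ∈ d ∷ xs
lastOr-∈ d [] = here refl
lastOr-∈ d (x ∷ xs) = there (lastOr-∈ x xs)

chain-++ : ∀ (h : ℕ → Poly n) x xs y ys →
           chain h ((x ∷ xs) ++ (y ∷ ys)) ≃
           chain h (x ∷ xs) *P ((h (lastOr x xs) -P h y) *P chain h (y ∷ ys))
chain-++ h x [] y ys = ≃-sym (*P-identityˡ _)
chain-++ h x (z ∷ xs) y ys =
  ≃-trans (*P-cong (≃-refl {p = h x -P h z}) (chain-++ h z xs y ys)) (≃-sym (*P-assoc (h x -P h z) _ _))

chain-cong : ∀ {h h′ : ℕ → Poly n} xs → (∀ {x} → x ∈ xs → h x ≃ h′ x) →
             chain h xs ≃ chain h′ xs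
chain-cong [] _ = ≃-refl
chain-cong (x ∷ []) _ = ≃-refl
chain-cong (x ∷ y ∷ xs) h≃h′ =
  *P-cong (+P-cong (h≃h′ (here refl)) (negP-cong (h≃h′ (there (here refl)))))
          (chain-cong (y ∷ xs) (h≃h′ ∘ there))

chain-translate : ∀ {h h′ : ℕ → Poly n} (c : Poly n) xs → (∀ {x} → x ∈ xs → h x ≃ h′ x +P c) →
                  chain h xs ≃ chain h′ xs
chain-translate c [] _ = ≃-refl
chain-translate c (x ∷ []) _ = ≃-refl
chain-translate {n} {h} {h′} c (x ∷ y ∷ xs) h≃h′+c =
  *P-cong (≃-trans (+P-cong (h≃h′+c (here refl)) (negP-cong (h≃h′+c (there (here refl)))))
                   (solve 3 (λ a b c → (a :+ c) :+ (:- (b :+ c)) := a :+ (:- b)) ≃-refl (h′ x) (h′ y) c))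
          (chain-translate c (y ∷ xs) (h≃h′+c ∘ there))
  where open PolySolver n

substP-chain : ∀ (τ : Fin n → Poly m) (h : ℕ → Poly n) xs →
               substP τ (chain h xs) ≃ chain (substP τ ∘ h) xs
substP-chain τ h [] = substP-oneP τ
substP-chain τ h (x ∷ []) = substP-oneP τ
substP-chain τ h (x ∷ y ∷ xs) =
  ≃-trans (substP-*P τ (h x -P h y) (chain h (y ∷ xs)))
          (*P-cong (substP--P τ (h x) (h y)) (substP-chain τ h (y ∷ xs)))

embed-chain : ∀ (h : ℕ → Poly n) xs → embed (chain h xs) ≃ chain (embed ∘ h) xs
embed-chain h [] = ≃-refl
embed-chain h (x ∷ []) = ≃-refl
embed-chain h (x ∷ y ∷ xs) =
  ≃-trans (embed-*P (h x -P h y) (chain h (y ∷ xs))) (*P-cong (embed--P (h x) (h y)) (embed-chain h (y ∷ xs)))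

chain-map : ∀ (h : ℕ → Poly n) (f : ℕ → ℕ) xs → chain h (map f xs) ≡ chain (h ∘ f) xs
chain-map h f [] = refl
chain-map h f (x ∷ []) = refl
chain-map h f (x ∷ y ∷ xs) = cong ((h (f x) -P h (f y)) *P_) (chain-map h f (y ∷ xs))

-- The shift of the second block of variables

module Shift (r₁ r₂ : ℕ) where

  N : ℕ
  N = r₁ + r₂

  σ : Fin N → Poly (suc N)
  σ = shiftσ r₁ r₂

  σˡ : Fin r₁ → Poly N
  σˡ i = varP (i ↑ˡ r₂)

  σʳ : Fin r₂ → Poly N
  σʳ i = varP (r₁ ↑ʳ i)

  IsIndex : ℕ → Set
  IsIndex i = ∃[ k ] i ≡ suc k × k < N

  IsLeft IsRight : ℕ → Set
  IsLeft i = IsIndex i × i ≤ r₁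
  IsRight i = IsIndex i × r₁ < i

  leftVar : ∀ {k} → k < r₁ → Fin N
  leftVar k<r₁ = fromℕ< k<r₁ ↑ˡ r₂

  toℕ-leftVar : ∀ {k} (k<r₁ : k < r₁) → toℕ (leftVar k<r₁) ≡ k
  toℕ-leftVar k<r₁ = trans (toℕ-↑ˡ (fromℕ< k<r₁) r₂) (toℕ-fromℕ< k<r₁)

  k∸r₁<r₂ : ∀ {k} → r₁ ≤ k → k < N → k ∸ r₁ < r₂
  k∸r₁<r₂ {k} r₁≤k k<N = subst (k ∸ r₁ <_) (ℕP.m+n∸m≡n r₁ r₂) (ℕP.∸-monoˡ-< k<N r₁≤k)

  rightVar : ∀ {k} → r₁ ≤ k → k < N → Fin N
  rightVar r₁≤k k<N = r₁ ↑ʳ fromℕ< (k∸r₁<r₂ r₁≤k k<N)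

  toℕ-rightVar : ∀ {k} (r₁≤k : r₁ ≤ k) (k<N : k < N) → toℕ (rightVar r₁≤k k<N) ≡ k
  toℕ-rightVar r₁≤k k<N = trans (toℕ-↑ʳ r₁ _)
    (trans (cong (r₁ +_) (toℕ-fromℕ< (k∸r₁<r₂ r₁≤k k<N))) (ℕP.m+[n∸m]≡n r₁≤k))

  σ-↑ˡ : ∀ (k : Fin r₁) → σ (k ↑ˡ r₂) ≡ varP (suc (k ↑ˡ r₂))
  σ-↑ˡ k rewrite splitAt-↑ˡ r₁ k r₂ = refl

  σ-↑ʳ : ∀ (k : Fin r₂) → σ (r₁ ↑ʳ k) ≡ varP (suc (r₁ ↑ʳ k)) +P tVar
  σ-↑ʳ k rewrite splitAt-↑ʳ r₁ r₂ k = refl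

  shift-X-left : ∀ {i} → IsLeft i → substP σ (X N i) ≃ embed (X N i)
  shift-X-left ((k , refl , _) , k<r₁) rewrite X≡varP N (suc k) (leftVar k<r₁) (toℕ-leftVar k<r₁) =
    ≃-trans (substP-varP σ (leftVar k<r₁))
    (≃-trans (≡⇒≃ (σ-↑ˡ (fromℕ< k<r₁))) (≃-sym (embed-varP (leftVar k<r₁))))

  shift-X-right : ∀ {i} → IsRight i → substP σ (X N i) ≃ embed (X N i) +P tVar
  shift-X-right ((k , refl , k<N) , s≤s r₁≤k)
    rewrite X≡varP N (suc k) (rightVar r₁≤k k<N) (toℕ-rightVar r₁≤k k<N) =
    ≃-trans (substP-varP σ (rightVar r₁≤k k<N))
    (≃-trans (≡⇒≃ (σ-↑ʳ (fromℕ< (k∸r₁<r₂ r₁≤k k<N))))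
             (+P-cong (≃-sym (embed-varP (rightVar r₁≤k k<N))) ≃-refl))

  σˡ-X : ∀ {k} → k < r₁ → substP σˡ (X r₁ (suc k)) ≃ X N (suc k)
  σˡ-X {k} k<r₁ rewrite X≡varP r₁ (suc k) (fromℕ< k<r₁) (toℕ-fromℕ< k<r₁)
                      | X≡varP N (suc k) (leftVar k<r₁) (toℕ-leftVar k<r₁) =
    substP-varP σˡ (fromℕ< k<r₁)

  σʳ-X : ∀ {k} → k < r₂ → substP σʳ (X r₂ (suc k)) ≃ X N (r₁ + suc k)
  σʳ-X {k} k<r₂
    rewrite X≡varP r₂ (suc k) (fromℕ< k<r₂) (toℕ-fromℕ< k<r₂)
          | X≡varP N (r₁ + suc k) (r₁ ↑ʳ fromℕ< k<r₂)
              (trans (toℕ-↑ʳ r₁ (fromℕ< k<r₂))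
                     (trans (cong (r₁ +_) (toℕ-fromℕ< k<r₂)) (cong (_∸ 1) (sym (ℕP.+-suc r₁ k))))) =
    substP-varP σʳ (fromℕ< k<r₂)

  σʳ-X-right : ∀ {i} → IsRight i → substP σʳ (X r₂ (i ∸ r₁)) ≃ X N i
  σʳ-X-right ((k , refl , k<N) , s≤s r₁≤k) =
    subst₂ (λ a b → substP σʳ (X r₂ a) ≃ X N b)
      (sym (ℕP.+-∸-assoc 1 r₁≤k)) (trans (ℕP.+-suc r₁ _) (cong suc (ℕP.m+[n∸m]≡n r₁≤k)))
      (σʳ-X (k∸r₁<r₂ r₁≤k k<N))

  shift-difference-left : ∀ {i j} → IsLeft i → IsLeft j →
                          substP σ (X N i -P X N j) ≃ embed (X N i -P X N j)
  shift-difference-left {i} {j} i-left j-left =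
    ≃-trans (substP--P σ (X N i) (X N j))
    (≃-trans (+P-cong (shift-X-left i-left) (negP-cong (shift-X-left j-left))) (≃-sym (embed--P (X N i) (X N j))))

  shift-difference-right : ∀ {i j} → IsRight i → IsRight j →
                           substP σ (X N i -P X N j) ≃ embed (X N i -P X N j)
  shift-difference-right {i} {j} i-right j-right =
    ≃-trans (substP--P σ (X N i) (X N j))
    (≃-trans (+P-cong (shift-X-right i-right) (negP-cong (shift-X-right j-right)))
    (≃-trans (solve 3 (λ a b t → (a :+ t) :+ (:- (b :+ t)) := a :+ (:- b)) ≃-refl
                      (embed (X N i)) (embed (X N j)) tVar)
             (≃-sym (embed--P (X N i) (X N j)))))
    where open PolySolver (suc N)

  shift-difference-mixed : ∀ {i j} → IsRight i → IsLeft j →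
                           substP σ (X N i -P X N j) ≃ embed (X N i -P X N j) +P tVar
  shift-difference-mixed {i} {j} i-right j-left =
    ≃-trans (substP--P σ (X N i) (X N j))
    (≃-trans (+P-cong (shift-X-right i-right) (negP-cong (shift-X-left j-left)))
    (≃-trans (solve 3 (λ a b t → (a :+ t) :+ (:- b) := (a :+ (:- b)) :+ t) ≃-refl
                      (embed (X N i)) (embed (X N j)) tVar)
             (+P-cong (≃-sym (embed--P (X N i) (X N j))) ≃-refl)))
    where open PolySolver (suc N)

  isRight : ℕ → Bool
  isRight i = r₁ ℕ.<ᵇ i

  mixed : ℕ → ℕ → Bool
  mixed i j = isRight i ∧ not (isRight j)

  factorDegree : ℕ → ℕ → ℕ
  factorDegree i j = if j ℕ.<ᵇ i then (if mixed i j then 1 else 0) else 0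

  factorLeading : ℕ → ℕ → Poly N
  factorLeading i j = if j ℕ.<ᵇ i then (if mixed i j then oneP else X N i -P X N j) else oneP

  differenceFactor-shiftsLeadingTerm : ∀ {i j} → IsIndex i → IsIndex j →
    ShiftsLeadingTerm (substP σ (differenceFactor N i j)) (factorDegree i j) (factorLeading i j)
  differenceFactor-shiftsLeadingTerm {suc i} {suc j} i-index@(_ , refl , _) j-index@(_ , refl , _)
    with j ℕ.<ᵇ i in j<i | isRight (suc i) in i-side | isRight (suc j) in j-side
  ... | false | _ | _ =
    ShiftsLeadingTerm-cong (≃-sym (substP-oneP σ)) ≃-refl (embed-shiftsLeadingTerm oneP)
  ... | true | false | _ =
    ShiftsLeadingTerm-cong (≃-sym (shift-difference-left i-left (j-index , j≤r₁))) ≃-refl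
      (embed-shiftsLeadingTerm (X N (suc i) -P X N (suc j)))
    where
    i-left = i-index , <ᵇ≡false⇒≥ i-side
    j≤r₁ = ℕP.<⇒≤ (ℕP.<-≤-trans (s≤s (<ᵇ≡true⇒< j<i)) (proj₂ i-left))
  ... | true | true | true =
    ShiftsLeadingTerm-cong
      (≃-sym (shift-difference-right (i-index , <ᵇ≡true⇒< i-side) (j-index , <ᵇ≡true⇒< j-side)))
      ≃-refl (embed-shiftsLeadingTerm (X N (suc i) -P X N (suc j)))
  ... | true | true | false =
    ShiftsLeadingTerm-cong
      (≃-sym (shift-difference-mixed (i-index , <ᵇ≡true⇒< i-side) (j-index , <ᵇ≡false⇒≥ j-side)))
      ≃-refl (embed+tVar-shiftsLeadingTerm (X N (suc i) -P X N (suc j)))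

  ΔDegree : List ℕ → ℕ
  ΔDegree S = sumOver S (λ i → sumOver S (factorDegree i))

  ΔLeading : List ℕ → Poly N
  ΔLeading S = ∏ S (λ i → ∏ S (factorLeading i))

  Δ-leadingTerm : ∀ S → (∀ {i} → i ∈ S → IsIndex i) →
                  LeadingTerm (substP σ (Δ N S)) (ΔDegree S) (ΔLeading S)
  Δ-leadingTerm S index = shiftsLeadingTerm⇒LeadingTerm (ShiftsLeadingTerm-cong
    (≃-sym (≃-trans (substP-cong σ (Δ≃differenceProduct N S))
           (≃-trans (substP-∏ σ S _) (∏-cong S (λ {i} _ → substP-∏ σ S (differenceFactor N i))))))
    ≃-refl
    (∏-shiftsLeadingTerm S _ _ _ λ i∈S → ∏-shiftsLeadingTerm S _ _ _ λ j∈S →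
      differenceFactor-shiftsLeadingTerm (index i∈S) (index j∈S)))

  indexPoint : Fin N → ℤ
  indexPoint k = ℤ.+ suc (toℕ k)

  eval-X : ∀ {i} → IsIndex i → eval indexPoint (X N i) ≡ ℤ.+ i
  eval-X (k , refl , k<N) rewrite X≡varP N (suc k) (fromℕ< k<N) (toℕ-fromℕ< k<N) =
    trans (eval-varP indexPoint (fromℕ< k<N)) (cong (λ z → ℤ.+ suc z) (toℕ-fromℕ< k<N))

  eval-factorLeading≢0 : ∀ {i j} → IsIndex i → IsIndex j → eval indexPoint (factorLeading i j) ≢ 0ℤ
  eval-factorLeading≢0 {i} {j} i-index j-index with j ℕ.<ᵇ i in j<i | mixed i j
  ... | false | _ = λ eq → contradiction (trans (sym (eval-oneP indexPoint)) eq) λ ()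
  ... | true | true = λ eq → contradiction (trans (sym (eval-oneP indexPoint)) eq) λ ()
  ... | true | false = λ eq →
    ℕP.<⇒≢ (<ᵇ≡true⇒< j<i) (sym (ℤP.+-injective (ℤP.i-j≡0⇒i≡j (ℤ.+ i) _ (i-j≡0 eq))))
    where
    i-j≡0 : eval indexPoint (X N i -P X N j) ≡ 0ℤ → ℤ.+ i ℤ.- ℤ.+ j ≡ 0ℤ
    i-j≡0 = trans (sym (trans (eval--P indexPoint (X N i) (X N j))
                              (cong₂ ℤ._-_ (eval-X i-index) (eval-X j-index))))

  eval-ΔLeading≢0 : ∀ S → (∀ {i} → i ∈ S → IsIndex i) → eval indexPoint (ΔLeading S) ≢ 0ℤ
  eval-ΔLeading≢0 S index = eval-∏≢0 indexPoint S _ λ i∈S → eval-∏≢0 indexPoint S _ λ j∈S →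
    eval-factorLeading≢0 (index i∈S) (index j∈S)

  Δ-hasNu : ∀ S → (∀ {i} → i ∈ S → IsIndex i) → HasNu r₁ r₂ (Δ N S) (ΔDegree S)
  Δ-hasNu S index =
    (λ zero-T → eval-ΔLeading≢0 S index
      (trans (sym (pair-≡ (leading lt) (evalMonomial indexPoint)))
             (IsZeroP⇒pair≡0 (T (ΔDegree S) r₁ r₂ (Δ N S)) zero-T _))) ,
    (λ j d<j → ≃⇒≈P (vanishes-above lt j d<j))
    where lt = Δ-leadingTerm S index

  factorDegree-left : ∀ i j → i ≤ r₁ → factorDegree i j ≡ 0
  factorDegree-left i j i≤r₁ rewrite ≥⇒<ᵇ≡false {r₁} {i} i≤r₁ with j ℕ.<ᵇ i
  ... | true = refl
  ... | false = refl

  factorDegree-mixed : ∀ i j → r₁ < i → j ≤ r₁ → factorDegree i j ≡ 1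
  factorDegree-mixed i j r₁<i j≤r₁
    rewrite <⇒<ᵇ≡true (ℕP.≤-<-trans j≤r₁ r₁<i) | <⇒<ᵇ≡true r₁<i | ≥⇒<ᵇ≡false {r₁} {j} j≤r₁
    = refl

  factorDegree-right : ∀ i j → r₁ < j → factorDegree i j ≡ 0
  factorDegree-right i j r₁<j rewrite <⇒<ᵇ≡true r₁<j with j ℕ.<ᵇ i | isRight i
  ... | true | true = refl
  ... | true | false = refl
  ... | false | _ = refl

  factorLeading-left : ∀ i j → i ≤ r₁ → factorLeading i j ≡ differenceFactor N i j
  factorLeading-left i j i≤r₁ rewrite ≥⇒<ᵇ≡false {r₁} {i} i≤r₁ with j ℕ.<ᵇ i
  ... | true = refl
  ... | false = refl

  factorLeading-right : ∀ i j → r₁ < j → factorLeading i j ≡ differenceFactor N i j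
  factorLeading-right i j r₁<j rewrite <⇒<ᵇ≡true r₁<j with j ℕ.<ᵇ i | isRight i
  ... | true | true = refl
  ... | true | false = refl
  ... | false | _ = refl

  factorLeading-upper : ∀ i j → i ≤ r₁ → r₁ < j → factorLeading i j ≡ oneP
  factorLeading-upper i j i≤r₁ r₁<j
    rewrite ≥⇒<ᵇ≡false {j} {i} (ℕP.<⇒≤ (ℕP.≤-<-trans i≤r₁ r₁<j)) = refl

  factorLeading-mixed : ∀ i j → r₁ < i → j ≤ r₁ → factorLeading i j ≡ oneP
  factorLeading-mixed i j r₁<i j≤r₁
    rewrite <⇒<ᵇ≡true (ℕP.≤-<-trans j≤r₁ r₁<i) | <⇒<ᵇ≡true r₁<i | ≥⇒<ᵇ≡false {r₁} {j} j≤r₁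
    = refl

  module Blocks (L R : List ℕ) (left : ∀ {i} → i ∈ L → IsLeft i)
                (right : ∀ {i} → i ∈ R → IsRight i) where

    index : ∀ {i} → i ∈ L ++ R → IsIndex i
    index i∈L++R with ∈-++⁻ L i∈L++R
    ... | inj₁ i∈L = proj₁ (left i∈L)
    ... | inj₂ i∈R = proj₁ (right i∈R)

    ≤r₁ : ∀ {i} → i ∈ L → i ≤ r₁
    ≤r₁ = proj₂ ∘ left

    r₁< : ∀ {i} → i ∈ R → r₁ < i
    r₁< = proj₂ ∘ right

    rowDegree-left : ∀ {i} → i ∈ L → sumOver (L ++ R) (factorDegree i) ≡ 0
    rowDegree-left {i} i∈L =
      trans (sumOver-const (L ++ R) _ 0 λ {j} _ → factorDegree-left i j (≤r₁ i∈L))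
            (ℕP.*-zeroʳ (length (L ++ R)))

    rowDegree-right : ∀ {i} → i ∈ R → sumOver (L ++ R) (factorDegree i) ≡ length L
    rowDegree-right {i} i∈R = begin
      sumOver (L ++ R) (factorDegree i)
        ≡⟨ sumOver-++ L R _ ⟩
      sumOver L (factorDegree i) + sumOver R (factorDegree i)
        ≡⟨ cong₂ _+_ (sumOver-const L _ 1 λ j∈L → factorDegree-mixed i _ (r₁< i∈R) (≤r₁ j∈L))
                     (sumOver-const R _ 0 λ j∈R → factorDegree-right i _ (r₁< j∈R)) ⟩
      length L * 1 + length R * 0
        ≡⟨ cong₂ _+_ (ℕP.*-identityʳ (length L)) (ℕP.*-zeroʳ (length R)) ⟩
      length L + 0
        ≡⟨ ℕP.+-identityʳ (length L) ⟩
      length L ∎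
      where open ≡-Reasoning

    ΔDegree-++ : ΔDegree (L ++ R) ≡ length R * length L
    ΔDegree-++ = begin
      ΔDegree (L ++ R)
        ≡⟨ sumOver-++ L R _ ⟩
      sumOver L (λ i → sumOver (L ++ R) (factorDegree i)) + sumOver R (λ i → sumOver (L ++ R) (factorDegree i))
        ≡⟨ cong₂ _+_ (sumOver-const L _ 0 rowDegree-left) (sumOver-const R _ (length L) rowDegree-right) ⟩
      length L * 0 + length R * length L
        ≡⟨ cong (_+ length R * length L) (ℕP.*-zeroʳ (length L)) ⟩
      length R * length L ∎
      where open ≡-Reasoning

    rowLeading-left : ∀ {i} → i ∈ L → ∏ (L ++ R) (factorLeading i) ≃ ∏ L (differenceFactor N i)
    rowLeading-left {i} i∈L =
      ≃-trans (∏-++ L R (factorLeading i))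
      (≃-trans (*P-cong (∏-cong L λ {j} _ → ≡⇒≃ (factorLeading-left i j (≤r₁ i∈L)))
                        (∏-≃oneP R _ λ {j} j∈R → ≡⇒≃ (factorLeading-upper i j (≤r₁ i∈L) (r₁< j∈R))))
               (*P-identityʳ _))

    rowLeading-right : ∀ {i} → i ∈ R → ∏ (L ++ R) (factorLeading i) ≃ ∏ R (differenceFactor N i)
    rowLeading-right {i} i∈R =
      ≃-trans (∏-++ L R (factorLeading i))
      (≃-trans (*P-cong (∏-≃oneP L _ λ {j} j∈L → ≡⇒≃ (factorLeading-mixed i j (r₁< i∈R) (≤r₁ j∈L)))
                        (∏-cong R λ {j} j∈R → ≡⇒≃ (factorLeading-right i j (r₁< j∈R))))
               (*P-identityˡ _))

    ΔLeading-++ : ΔLeading (L ++ R) ≃ differenceProduct N L *P differenceProduct N R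
    ΔLeading-++ = ≃-trans (∏-++ L R _) (*P-cong (∏-cong L rowLeading-left) (∏-cong R rowLeading-right))

  leftBlock rightBlock : List ℕ
  leftBlock = range1 r₁
  rightBlock = map (r₁ +_) (range1 r₂)

  leftBlock-left : ∀ {i} → i ∈ leftBlock → IsLeft i
  leftBlock-left i∈L with ∈-range1⁻ i∈L
  ... | k , refl , k<r₁ = (k , refl , ℕP.<-≤-trans k<r₁ (ℕP.m≤m+n r₁ r₂)) , k<r₁

  rightBlock-right : ∀ {i} → i ∈ rightBlock → IsRight i
  rightBlock-right i∈R with ∈-map⁻ (r₁ +_) i∈R
  ... | j , j∈range , refl with ∈-range1⁻ j∈range
  ...   | k , refl , k<r₂ =
    (r₁ + k , ℕP.+-suc r₁ k , ℕP.+-monoʳ-< r₁ k<r₂) , ℕP.m<m+n r₁ (s≤s z≤n)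

  range1-N : range1 N ≡ leftBlock ++ rightBlock
  range1-N = range1-+ r₁ r₂

  ⊗P-Δ : Δ r₁ (range1 r₁) ⊗P Δ r₂ (range1 r₂) ≃
         differenceProduct N leftBlock *P differenceProduct N rightBlock
  ⊗P-Δ = *P-cong
    (≃-trans (substP-cong σˡ (Δ≃differenceProduct r₁ leftBlock))
      (subst (λ S → substP σˡ (differenceProduct r₁ leftBlock) ≃ differenceProduct N S) (map-id leftBlock)
        (substP-differenceProduct σˡ (λ i → i) leftBlock σˡ-X-range (λ _ _ → refl))))
    (≃-trans (substP-cong σʳ (Δ≃differenceProduct r₂ (range1 r₂)))
      (substP-differenceProduct σʳ (r₁ +_) (range1 r₂) σʳ-X-range (+-<ᵇ r₁)))
    where
    σˡ-X-range : ∀ {i} → i ∈ range1 r₁ → substP σˡ (X r₁ i) ≃ X N i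
    σˡ-X-range i∈range with ∈-range1⁻ i∈range
    ... | _ , refl , k<r₁ = σˡ-X k<r₁
    σʳ-X-range : ∀ {i} → i ∈ range1 r₂ → substP σʳ (X r₂ i) ≃ X N (r₁ + i)
    σʳ-X-range i∈range with ∈-range1⁻ i∈range
    ... | _ , refl , k<r₂ = σʳ-X k<r₂

  open module BlocksN = Blocks leftBlock rightBlock leftBlock-left rightBlock-right
    using (ΔDegree-++; ΔLeading-++)

  blocksDegree : ΔDegree (leftBlock ++ rightBlock) ≡ r₁ * r₂
  blocksDegree =
    trans ΔDegree-++
    (trans (cong₂ _*_ (trans (length-map (r₁ +_) (range1 r₂)) (length-range1 r₂)) (length-range1 r₁))
           (ℕP.*-comm r₂ r₁))

  Δ-range1-hasNu : HasNu r₁ r₂ (Δ N (range1 N)) (r₁ * r₂)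
  Δ-range1-hasNu rewrite range1-N =
    subst (HasNu r₁ r₂ (Δ N (leftBlock ++ rightBlock))) blocksDegree (Δ-hasNu _ BlocksN.index)

  Δ-range1-leading :
    T (r₁ * r₂) r₁ r₂ (Δ N (range1 N)) ≈P (Δ r₁ (range1 r₁) ⊗P Δ r₂ (range1 r₂))
  Δ-range1-leading rewrite range1-N | sym blocksDegree =
    ≃⇒≈P (≃-trans (leading (Δ-leadingTerm _ BlocksN.index)) (≃-trans ΔLeading-++ (≃-sym ⊗P-Δ)))

  module ChainSplit (x₀ : ℕ) (L′ : List ℕ) (y₀ : ℕ) (R′ : List ℕ)
                    (left : ∀ {i} → i ∈ x₀ ∷ L′ → IsLeft i)
                    (right : ∀ {i} → i ∈ y₀ ∷ R′ → IsRight i) where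

    L R : List ℕ
    L = x₀ ∷ L′
    R = y₀ ∷ R′

    chainL chainR : Poly N
    chainL = chain (X N) L
    chainR = chain (X N) R

    shift-chainL : substP σ chainL ≃ embed chainL
    shift-chainL = ≃-trans (substP-chain σ (X N) L)
                   (≃-trans (chain-cong L (shift-X-left ∘ left)) (≃-sym (embed-chain (X N) L)))

    shift-chainR : substP σ chainR ≃ embed chainR
    shift-chainR = ≃-trans (substP-chain σ (X N) R)
                   (≃-trans (chain-translate tVar R (shift-X-right ∘ right)) (≃-sym (embed-chain (X N) R)))

    aFirst aLast aLeftEnd aRightStart : Poly N
    aFirst = X N x₀
    aLast = X N (lastOr y₀ R′)
    aLeftEnd = X N (lastOr x₀ L′)
    aRightStart = X N y₀

    ψ-split : ψ N (L ++ R) ≃ (aLast -P aFirst) *P (chainL *P ((aLeftEnd -P aRightStart) *P chainR))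
    ψ-split = ≃-trans
      (≡⇒≃ (cong₂ (λ a c → (X N a -P aFirst) *P c)
                  (lastOr-++ x₀ L′ y₀ R′) (ψ′≡chain N (L ++ R))))
      (*P-cong (≃-refl {p = aLast -P aFirst}) (chain-++ (X N) x₀ L′ y₀ R′))

    shift-ψ-split :
      substP σ ((aLast -P aFirst) *P (chainL *P ((aLeftEnd -P aRightStart) *P chainR))) ≃
      ((embed aLast +P tVar) -P embed aFirst) *P
        (embed chainL *P ((embed aLeftEnd -P (embed aRightStart +P tVar)) *P embed chainR))
    shift-ψ-split =
      ≃-trans (substP-*P σ (aLast -P aFirst) _)
      (*P-cong shift-cycle
      (≃-trans (substP-*P σ chainL _)
      (*P-cong shift-chainL
      (≃-trans (substP-*P σ (aLeftEnd -P aRightStart) chainR) (*P-cong shift-cross shift-chainR)))))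
      where
      shift-cycle : substP σ (aLast -P aFirst) ≃ (embed aLast +P tVar) -P embed aFirst
      shift-cycle = ≃-trans (substP--P σ aLast aFirst)
        (+P-cong (shift-X-right (right (lastOr-∈ y₀ R′))) (negP-cong (shift-X-left (left (here refl)))))
      shift-cross : substP σ (aLeftEnd -P aRightStart) ≃ embed aLeftEnd -P (embed aRightStart +P tVar)
      shift-cross = ≃-trans (substP--P σ aLeftEnd aRightStart)
        (+P-cong (shift-X-left (left (lastOr-∈ x₀ L′))) (negP-cong (shift-X-right (right (here refl)))))

    -- The two differences joining the blocks, oriented so that both gain +t.
    cycleStep crossStep : Poly N
    cycleStep = aLast -P aFirst
    crossStep = aRightStart -P aLeftEnd

    shiftedψ : Poly (suc N)
    shiftedψ = (embed cycleStep +P tVar) *P ((embed crossStep +P tVar) *P embed (chainL *P chainR))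

    shift-ψ : substP σ (ψ N (L ++ R)) ≃ negP shiftedψ
    shift-ψ = begin
        substP σ (ψ N (L ++ R))
      ≈⟨ ≃-trans (substP-cong σ ψ-split) shift-ψ-split ⟩
        ((embed A +P tVar) -P embed F) *P (embed chainL *P ((embed M -P (embed H +P tVar)) *P embed chainR))
      ≈⟨ solve 7 (λ a f m h t l r →
            ((a :+ t) :+ (:- f)) :* (l :* ((m :+ (:- (h :+ t))) :* r))
         := :- (((a :+ (:- f)) :+ t) :* (((h :+ (:- m)) :+ t) :* (l :* r))))
         ≃-refl (embed A) (embed F) (embed M) (embed H) tVar (embed chainL) (embed chainR) ⟩
        negP (((embed A -P embed F) +P tVar) *P (((embed H -P embed M) +P tVar) *P (embed chainL *P embed chainR)))
      ≈⟨ negP-cong (*P-cong (+P-cong (≃-sym (embed--P A F)) ≃-refl)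
                   (*P-cong (+P-cong (≃-sym (embed--P H M)) ≃-refl) (≃-sym (embed-*P chainL chainR)))) ⟩
        negP shiftedψ ∎
      where
      open PolySolver (suc N)
      A = aLast
      F = aFirst
      M = aLeftEnd
      H = aRightStart

    shiftedψ-leadingTerm : LeadingTerm shiftedψ 2 (oneP *P (oneP *P (chainL *P chainR)))
    shiftedψ-leadingTerm = shiftsLeadingTerm⇒LeadingTerm
      (*P-shiftsLeadingTerm (embed+tVar-shiftsLeadingTerm cycleStep)
        (*P-shiftsLeadingTerm (embed+tVar-shiftsLeadingTerm crossStep) (embed-shiftsLeadingTerm (chainL *P chainR))))

    chains≃⊗P : chainL *P chainR ≃ ψ' r₁ L ⊗P ψ' r₂ (map (_∸ r₁) R)
    chains≃⊗P = *P-cong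
      (≃-sym (≃-trans (≡⇒≃ (cong (substP σˡ) (ψ′≡chain r₁ L)))
             (≃-trans (substP-chain σˡ (X r₁) L) (chain-cong L σˡ-X-left))))
      (≃-sym (≃-trans (≡⇒≃ (cong (substP σʳ)
                              (trans (ψ′≡chain r₂ (map (_∸ r₁) R)) (chain-map (X r₂) (_∸ r₁) R))))
             (≃-trans (substP-chain σʳ (λ i → X r₂ (i ∸ r₁)) R)
                      (chain-cong R (σʳ-X-right ∘ right)))))
      where
      σˡ-X-left : ∀ {i} → i ∈ L → substP σˡ (X r₁ i) ≃ X N i
      σˡ-X-left i∈L with left i∈L
      ... | (_ , refl , _) , k<r₁ = σˡ-X k<r₁

    tCoeff₂-ψ : tCoeff 2 (substP σ (ψ N (L ++ R))) ≃ negP (ψ' r₁ L ⊗P ψ' r₂ (map (_∸ r₁) R))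
    tCoeff₂-ψ =
      ≃-trans (tCoeff-cong 2 shift-ψ)
      (≃-trans (tCoeff-negP 2 shiftedψ)
      (negP-cong (≃-trans (leading shiftedψ-leadingTerm)
                 (≃-trans (*P-identityˡ _) (≃-trans (*P-identityˡ _) chains≃⊗P)))))

  ψ-T₂ : 0 < r₁ → 0 < r₂ → (e : List ℕ) → e ↭ range1 N → SameSet (take r₁ e) (range1 r₁) →
         T 2 r₁ r₂ (ψ N e) ≈P negP (ψ' r₁ (take r₁ e) ⊗P ψ' r₂ (map (_∸ r₁) (drop r₁ e)))
  ψ-T₂ 0<r₁ 0<r₂ e e↭range sameSet =
    subst (λ e′ → T 2 r₁ r₂ (ψ N e′) ≈P negP (ψ' r₁ eL ⊗P ψ' r₂ (map (_∸ r₁) eR)))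
          (take++drop≡id r₁ e)
      (≃⇒≈P (split eL eR eL-left eR-right length-eL length-eR))
    where
    eL eR : List ℕ
    eL = take r₁ e
    eR = drop r₁ e

    length-e : length e ≡ N
    length-e = trans (↭-length e↭range) (length-range1 N)

    length-eL : length eL ≡ r₁
    length-eL =
      trans (length-take r₁ e) (trans (cong (r₁ ℕ.⊓_) length-e) (ℕP.m≤n⇒m⊓n≡m (ℕP.m≤m+n r₁ r₂)))

    length-eR : length eR ≡ r₂
    length-eR = trans (length-drop r₁ e) (trans (cong (_∸ r₁) length-e) (ℕP.m+n∸m≡n r₁ r₂))

    unique-eL++eR : Unique (eL ++ eR)
    unique-eL++eR = subst Unique (sym (take++drop≡id r₁ e))
      (Unique-resp-↭ (↭⇒↭ₛ (↭-sym e↭range)) (Unique.map⁺ ℕP.suc-injective (Unique.upTo⁺ N)))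

    eL-left : ∀ {i} → i ∈ eL → IsLeft i
    eL-left i∈eL = leftBlock-left (Equivalence.to (sameSet _) i∈eL)

    eR-right : ∀ {i} → i ∈ eR → IsRight i
    eR-right {i} i∈eR
      with ∈-range1⁻ (∈-resp-↭ e↭range (subst (i ∈_) (take++drop≡id r₁ e) (∈-++⁺ʳ eL i∈eR)))
    ... | k , refl , k<N = (k , refl , k<N) , ℕP.≰⇒> λ i≤r₁ →
      Unique-++⇒disjoint eL unique-eL++eR
        (Equivalence.from (sameSet _) (∈-map⁺ suc (∈-upTo⁺ i≤r₁))) i∈eR

    split : ∀ L R → (∀ {i} → i ∈ L → IsLeft i) → (∀ {i} → i ∈ R → IsRight i) →
            length L ≡ r₁ → length R ≡ r₂ →
            tCoeff 2 (substP σ (ψ N (L ++ R))) ≃ negP (ψ' r₁ L ⊗P ψ' r₂ (map (_∸ r₁) R))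
    split [] R _ _ refl _ = contradiction 0<r₁ λ ()
    split (x₀ ∷ L′) [] _ _ _ refl = contradiction 0<r₂ λ ()
    split (x₀ ∷ L′) (y₀ ∷ R′) left right _ _ = ChainSplit.tCoeff₂-ψ x₀ L′ y₀ R′ left right

-- The index sets B_g, U_g and U'_g

module Parity (g₁ g₂ : ℕ) where

  r₁ r₂ : ℕ
  r₁ = 2 * g₁ + 1
  r₂ = 2 * g₂ + 1

  open Shift r₁ r₂

  N≡2g+2 : N ≡ 2 * (g₁ + g₂) + 2
  N≡2g+2 = solve-∀′ g₁ g₂
    where
    solve-∀′ : ∀ a b → (2 * a + 1) + (2 * b + 1) ≡ 2 * (a + b) + 2
    solve-∀′ = solve-∀

  bounds⇒left : ∀ {i} → 1 ≤ i → i ≤ r₁ → IsLeft i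
  bounds⇒left {suc k} _ i≤r₁ = (k , refl , ℕP.<-≤-trans i≤r₁ (ℕP.m≤m+n r₁ r₂)) , i≤r₁

  bounds⇒right : ∀ {i} → r₁ < i → i ≤ N → IsRight i
  bounds⇒right {suc k} r₁<i i≤N = (k , refl , i≤N) , r₁<i

  odd even : ℕ → ℕ
  odd k = 2 * k + 1
  even k = 2 * k + 2

  odd-mono-≤ : ∀ {k g} → k ≤ g → odd k ≤ odd g
  odd-mono-≤ k≤g = ℕP.+-monoˡ-≤ 1 (ℕP.*-monoʳ-≤ 2 k≤g)

  odd≤N : ∀ {k} → k ≤ g₁ + g₂ → odd k ≤ N
  odd≤N {k} k≤g = subst (odd k ≤_) (sym N≡2g+2)
    (ℕP.≤-trans (odd-mono-≤ k≤g) (ℕP.+-monoʳ-≤ (2 * (g₁ + g₂)) (ℕP.n≤1+n 1)))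

  even≤N : ∀ {k} → k ≤ g₁ + g₂ → even k ≤ N
  even≤N {k} k≤g = subst (even k ≤_) (sym N≡2g+2) (ℕP.+-monoˡ-≤ 2 (ℕP.*-monoʳ-≤ 2 k≤g))

  odd-left : ∀ {k} → k ≤ g₁ → IsLeft (odd k)
  odd-left {k} k≤g₁ = bounds⇒left (ℕP.m≤n+m 1 (2 * k)) (odd-mono-≤ k≤g₁)

  odd-right : ∀ {k} → g₁ < k → k ≤ g₁ + g₂ → IsRight (odd k)
  odd-right g₁<k k≤g = bounds⇒right (ℕP.+-monoˡ-< 1 (ℕP.*-monoʳ-< 2 g₁<k)) (odd≤N k≤g)

  even-left : ∀ {k} → k < g₁ → IsLeft (even k)
  even-left {k} k<g₁ = bounds⇒left (ℕP.≤-trans (s≤s z≤n) (ℕP.m≤n+m 2 (2 * k)))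
    (ℕP.≤-trans (ℕP.≤-reflexive (2k+2≡2[1+k] k))
                (ℕP.≤-trans (ℕP.*-monoʳ-≤ 2 k<g₁) (ℕP.m≤m+n (2 * g₁) 1)))
    where
    2k+2≡2[1+k] : ∀ k → 2 * k + 2 ≡ 2 * suc k
    2k+2≡2[1+k] = solve-∀

  even-right : ∀ {k} → g₁ ≤ k → k ≤ g₁ + g₂ → IsRight (even k)
  even-right g₁≤k k≤g = bounds⇒right
    (ℕP.≤-trans (ℕP.≤-reflexive (sym (ℕP.+-suc (2 * g₁) 1))) (ℕP.+-monoˡ-≤ 2 (ℕP.*-monoʳ-≤ 2 g₁≤k)))
    (even≤N k≤g)

  oddsLeft oddsRight evensLeft evensRight : List ℕ
  oddsLeft = map odd (upTo (suc g₁))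
  oddsRight = map odd (applyUpTo (suc g₁ +_) g₂)
  evensLeft = map even (upTo g₁)
  evensRight = map even (applyUpTo (g₁ +_) (suc g₂))

  U-split : U (g₁ + g₂) ≡ oddsLeft ++ oddsRight
  U-split = trans (cong (map odd) (applyUpTo-+ (λ i → i) (suc g₁) g₂)) (map-++ odd (upTo (suc g₁)) _)

  U′-split : U' (g₁ + g₂) ≡ evensLeft ++ evensRight
  U′-split = trans (cong (map even) (trans (cong upTo (sym (ℕP.+-suc g₁ g₂)))
                                          (applyUpTo-+ (λ i → i) g₁ (suc g₂))))
                   (map-++ even (upTo g₁) _)

  oddsLeft-left : ∀ {i} → i ∈ oddsLeft → IsLeft i
  oddsLeft-left i∈L with ∈-map⁻ odd {xs = upTo (suc g₁)} i∈L
  ... | k , k∈upTo , refl = odd-left (ℕP.m<1+n⇒m≤n (∈-upTo⁻ k∈upTo))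

  oddsRight-right : ∀ {i} → i ∈ oddsRight → IsRight i
  oddsRight-right i∈R with ∈-map⁻ odd i∈R
  ... | _ , j∈applyUpTo , refl with ∈-applyUpTo⁻ (suc g₁ +_) j∈applyUpTo
  ...   | y , y<g₂ , refl = odd-right (s≤s (ℕP.m≤m+n g₁ y)) (ℕP.+-monoʳ-< g₁ y<g₂)

  evensLeft-left : ∀ {i} → i ∈ evensLeft → IsLeft i
  evensLeft-left i∈L with ∈-map⁻ even i∈L
  ... | k , k∈upTo , refl = even-left (∈-upTo⁻ k∈upTo)

  evensRight-right : ∀ {i} → i ∈ evensRight → IsRight i
  evensRight-right i∈R with ∈-map⁻ even {xs = applyUpTo (g₁ +_) (suc g₂)} i∈R
  ... | _ , j∈applyUpTo , refl with ∈-applyUpTo⁻ (g₁ +_) {n = suc g₂} j∈applyUpTo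
  ...   | y , y<1+g₂ , refl =
    even-right (ℕP.m≤m+n g₁ y) (ℕP.+-monoʳ-≤ g₁ (ℕP.m<1+n⇒m≤n y<1+g₂))

  module Odds = Blocks oddsLeft oddsRight oddsLeft-left oddsRight-right
  module Evens = Blocks evensLeft evensRight evensLeft-left evensRight-right

  ΔU-hasNu : HasNu r₁ r₂ (Δ N (U (g₁ + g₂))) ((g₁ + 1) * g₂)
  ΔU-hasNu = subst₂ (λ S → HasNu r₁ r₂ (Δ N S)) (sym U-split) degree (Δ-hasNu _ Odds.index)
    where
    degree : ΔDegree (oddsLeft ++ oddsRight) ≡ (g₁ + 1) * g₂
    degree = begin
      ΔDegree (oddsLeft ++ oddsRight)
        ≡⟨ Odds.ΔDegree-++ ⟩
      length oddsRight * length oddsLeft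
        ≡⟨ cong₂ _*_ (trans (length-map odd (applyUpTo (suc g₁ +_) g₂))
                            (length-applyUpTo (suc g₁ +_) g₂))
                     (trans (length-map odd (upTo (suc g₁))) (length-upTo (suc g₁))) ⟩
      g₂ * suc g₁
        ≡⟨ trans (ℕP.*-comm g₂ (suc g₁)) (cong (_* g₂) (ℕP.+-comm 1 g₁)) ⟩
      (g₁ + 1) * g₂ ∎
      where open ≡-Reasoning

  ΔU′-hasNu : HasNu r₁ r₂ (Δ N (U' (g₁ + g₂))) (g₁ * (g₂ + 1))
  ΔU′-hasNu = subst₂ (λ S → HasNu r₁ r₂ (Δ N S)) (sym U′-split) degree (Δ-hasNu _ Evens.index)
    where
    degree : ΔDegree (evensLeft ++ evensRight) ≡ g₁ * (g₂ + 1)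
    degree = begin
      ΔDegree (evensLeft ++ evensRight)
        ≡⟨ Evens.ΔDegree-++ ⟩
      length evensRight * length evensLeft
        ≡⟨ cong₂ _*_ (trans (length-map even (applyUpTo (g₁ +_) (suc g₂)))
                            (length-applyUpTo (g₁ +_) (suc g₂)))
                     (trans (length-map even (upTo g₁)) (length-upTo g₁)) ⟩
      suc g₂ * g₁
        ≡⟨ trans (ℕP.*-comm (suc g₂) g₁) (cong (g₁ *_) (ℕP.+-comm 1 g₂)) ⟩
      g₁ * (g₂ + 1) ∎
      where open ≡-Reasoning

  B≡range1 : B (g₁ + g₂) ≡ range1 N
  B≡range1 = cong range1 (sym N≡2g+2)

  topDegree≡r₁*r₂ : 4 * g₁ * g₂ + 2 * g₁ + 2 * g₂ + 1 ≡ r₁ * r₂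
  topDegree≡r₁*r₂ = expand g₁ g₂
    where
    expand : ∀ a b → 4 * a * b + 2 * a + 2 * b + 1 ≡ (2 * a + 1) * (2 * b + 1)
    expand = solve-∀

  0<r₁ : 0 < r₁
  0<r₁ = ℕP.m≤n+m 1 (2 * g₁)

  0<r₂ : 0 < r₂
  0<r₂ = ℕP.m≤n+m 1 (2 * g₂)

proposition2p7 : (g₁ g₂ : ℕ) → 1 ≤ g₁ → 1 ≤ g₂ →
    let g = g₁ + g₂
        r₁ = 2 * g₁ + 1
        r₂ = 2 * g₂ + 1
    in
    -- (1)
    (HasNu r₁ r₂ (Δ (r₁ + r₂) (B g)) (r₁ * r₂)
      × T (4 * g₁ * g₂ + 2 * g₁ + 2 * g₂ + 1) r₁ r₂ (Δ (r₁ + r₂) (B g))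
          ≈P (Δ r₁ (range1 r₁) ⊗P Δ r₂ (range1 r₂)))
    -- (2)
    × (HasNu r₁ r₂ (Δ (r₁ + r₂) (U g)) ((g₁ + 1) * g₂)
      × HasNu r₁ r₂ (Δ (r₁ + r₂) (U' g)) (g₁ * (g₂ + 1)))
    -- (3)
    × ((e : List ℕ) → InE (2 * g + 2) e → SameSet (take r₁ e) (range1 r₁) →
        T 2 r₁ r₂ (ψ (r₁ + r₂) e)
          ≈P negP (ψ' r₁ (take r₁ e) ⊗P ψ' r₂ (map (λ x → x ∸ r₁) (drop r₁ e))))
proposition2p7 g₁ g₂ _ _ =
  ( subst (λ S → HasNu r₁ r₂ (Δ N S) (r₁ * r₂)) (sym B≡range1) Δ-range1-hasNu
  , subst₂ (λ d S → T d r₁ r₂ (Δ N S) ≈P (Δ r₁ (range1 r₁) ⊗P Δ r₂ (range1 r₂)))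
      (sym topDegree≡r₁*r₂) (sym B≡range1) Δ-range1-leading )
  , (ΔU-hasNu , ΔU′-hasNu)
  , λ e (e↭B , _) → ψ-T₂ 0<r₁ 0<r₂ e (subst (e ↭_) B≡range1 e↭B)
  where
  open Parity g₁ g₂
  open Shift r₁ r₂
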